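{- Let $G_1$ be a reduced graph (as defined in the context) and let $H$ be a maximum path-cycle cover of $G_1$ in which every cycle component has at least four edges, and such that (i) every singleton of $H$ is adjacent, via an edge of $G_1$, to an inner vertex of some path component of $H$, and (ii) every path component of $H$ of length $1$, $2$ or $3$ has an endpoint adjacent, via an edge of $G_1$, to an inner vertex of a path component of $H$ of length at least four. Then there is a $\frac{3}{4}$-approximate spanning forest of $G_1$ such that every connected component of $H$ joins one tree of it.
   Context: Throughout, $G_1$ is a connected undirected simple graph which is not a tree and which is reduced, meaning: (R1) every edge of $G_1$ whose two ends are each adjacent to a leaf (degree-$1$ vertex) of $G_1$ is a cut edge of $G_1$; (R2) no cut vertex of $G_1$ adjacent to a leaf of $G_1$ is super (a cut vertex is super if deleting it increases the number of connected components by at least $2$). It is assumed that no maximum path-cycle cover of $G_1$ consists of a single connected component. A path-cycle cover of $G_1$ is a spanning subgraph in which every vertex has degree at most $2$; it is maximum if it has the maximum number of edges among all path-cycle covers. Its components are path components and cycle components; the length of a path is its number of edges; a path of length $0$ is a singleton; a vertex of a path component is inner if its degree in the path is $2$ and an endpoint otherwise. For a subtree $T$ of $G_1$: a path component $p$ of $H$ joins $T$ if $V(p)\subseteq V(T)$ and $E(p)\subseteq E(T)$; a cycle component $c$ of $H$ joins $T$ if $V(c)\subseteq V(T)$ and $|E(c)\cap E(T)|\ge |E(c)|-1$. For $0\le\alpha\le 1$, $T$ is $\alpha$-approximate if the number of internal vertices of $T$ (vertices of degree at least $2$ in $T$) is at least $\alpha$ times the total number of edges of the components of $H$ that join $T$.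 A (spanning) forest of $G_1$ is $\alpha$-approximate if all its trees are $\alpha$-approximate; a component of $H$ joins the forest if it joins one of its trees. -}

module Defs where

open import Data.Nat using (ℕ; zero; suc; _+_; _*_; _≤_; _<_; _≤?_)
open import Data.Bool using (Bool; true; false; _∧_; _∨_; not; if_then_else_)
open import Data.Fin using (Fin; zero; suc; inject₁; fromℕ)
import Data.Fin.Properties as FinP
open import Data.Product using (Σ; ∃; _×_; _,_)
open import Data.Sum using (_⊎_)
open import Relation.Nullary using (¬_)
open import Relation.Nullary.Decidable using (⌊_⌋)
open import Relation.Binary.PropositionalEquality using (_≡_)

VSet : ℕ → Set
VSet n = Fin n → Bool

ESet : ℕ → Set
ESet n = Fin n → Fin n → Bool

record SimpleGraph (n : ℕ) : Set where
  field
    adj    : ESet n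
    sym    : ∀ u v → adj u v ≡ adj v u
    irrefl : ∀ v → adj v v ≡ false
open SimpleGraph public

count : ∀ {n} → (Fin n → Bool) → ℕ
count {zero}  f = 0
count {suc n} f = (if f zero then 1 else 0) + count (λ i → f (suc i))

sumF : ∀ {n} → (Fin n → ℕ) → ℕ
sumF {zero}  f = 0
sumF {suc n} f = f zero + sumF (λ i → f (suc i))

eqF : ∀ {n} → Fin n → Fin n → Bool
eqF a b = ⌊ a FinP.≟ b ⌋

ltF : ∀ {n} → Fin n → Fin n → Bool
ltF a b = ⌊ a FinP.<? b ⌋

deg : ∀ {n} → ESet n → Fin n → ℕ
deg E v = count (E v)

edgeCount : ∀ {n} → ESet n → ℕ
edgeCount E = sumF (λ i → count (λ j → E i j ∧ ltF i j))

restrictE : ∀ {n} → VSet n → ESet n → ESet n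
restrictE W E a b = W a ∧ W b ∧ E a b

allV : ∀ {n} → VSet n
allV _ = true

data Walk {n} (E : ESet n) : Fin n → Fin n → Set where
  here : ∀ {v} → Walk E v v
  step : ∀ {u w v} → E u w ≡ true → Walk E w v → Walk E u v

Connected : ∀ {n} → ESet n → Set
Connected E = ∀ u v → Walk E u v

-- The graph (W, restrictE W E) has exactly k connected components:
-- a surjective labelling of W by Fin k whose fibres are the components.
NComp : ∀ {n} → VSet n → ESet n → ℕ → Set
NComp {n} W E k =
  Σ (Fin n → Fin k) λ f →
    (∀ u v → W u ≡ true → W v ≡ true →
       (f u ≡ f v → Walk (restrictE W E) u v) ×
       (Walk (restrictE W E) u v → f u ≡ f v)) ×
    (∀ c → ∃ λ u → W u ≡ true × f u ≡ c)

IsComp : ∀ {n} → ESet n → VSet n → Set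
IsComp {n} E C =
  (∃ λ v → C v ≡ true) ×
  (∀ u → C u ≡ true → ∀ v → (C v ≡ true → Walk E u v) × (Walk E u v → C v ≡ true))

HasCycle : ∀ {n} → ESet n → Set
HasCycle {n} E =
  ∃ λ m → Σ (Fin (suc (suc (suc m))) → Fin n) λ f →
    (∀ i j → f i ≡ f j → i ≡ j) ×
    (∀ (i : Fin (suc (suc m))) → E (f (inject₁ i)) (f (suc i)) ≡ true) ×
    (E (f (fromℕ (suc (suc m)))) (f zero) ≡ true)

Acyclic : ∀ {n} → ESet n → Set
Acyclic E = ¬ HasCycle E

IsTree : ∀ {n} → SimpleGraph n → Set
IsTree G = Connected (adj G) × Acyclic (adj G)

SubEdges : ∀ {n} → SimpleGraph n → ESet n → Set
SubEdges G F = (∀ u v → F u v ≡ true → adj G u v ≡ true) × (∀ u v → F u v ≡ F v u)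

-- spanning forest of G: an acyclic spanning subgraph; its trees are the
-- components (D, restrictE D F) for IsComp F D.
SpanningForest : ∀ {n} → SimpleGraph n → ESet n → Set
SpanningForest G F = SubEdges G F × Acyclic F

Leaf : ∀ {n} → SimpleGraph n → Fin n → Set
Leaf G v = deg (adj G) v ≡ 1

AdjToLeaf : ∀ {n} → SimpleGraph n → Fin n → Set
AdjToLeaf G v = ∃ λ l → Leaf G l × adj G v l ≡ true

delEdge : ∀ {n} → SimpleGraph n → Fin n → Fin n → ESet n
delEdge G u v a b = adj G a b ∧ not ((eqF a u ∧ eqF b v) ∨ (eqF a v ∧ eqF b u))

delV : ∀ {n} → Fin n → VSet n
delV x a = not (eqF a x)

CutEdge : ∀ {n} → SimpleGraph n → Fin n → Fin n → Set
CutEdge G u v = ∃ λ k → ∃ λ k' →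
  NComp allV (adj G) k × NComp allV (delEdge G u v) k' × k < k'

CutVertex : ∀ {n} → SimpleGraph n → Fin n → Set
CutVertex G x = ∃ λ k → ∃ λ k' →
  NComp allV (adj G) k × NComp (delV x) (adj G) k' × k < k'

SuperVertex : ∀ {n} → SimpleGraph n → Fin n → Set
SuperVertex G x = CutVertex G x × (∃ λ k → ∃ λ k' →
  NComp allV (adj G) k × NComp (delV x) (adj G) k' × k + 2 ≤ k')

Reduced : ∀ {n} → SimpleGraph n → Set
Reduced G =
  (∀ u v → adj G u v ≡ true → AdjToLeaf G u → AdjToLeaf G v → CutEdge G u v) ×
  (∀ x → CutVertex G x → AdjToLeaf G x → ¬ SuperVertex G x)

PCC : ∀ {n} → SimpleGraph n → ESet n → Set
PCC G H = SubEdges G H × (∀ v → deg H v ≤ 2)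

MaxPCC : ∀ {n} → SimpleGraph n → ESet n → Set
MaxPCC G H = PCC G H × (∀ H' → PCC G H' → edgeCount H' ≤ edgeCount H)

-- number of edges (= length, for a path) of the component C of H
compEdges : ∀ {n} → ESet n → VSet n → ℕ
compEdges H C = edgeCount (restrictE C H)

IsCycleComp : ∀ {n} → ESet n → VSet n → Set
IsCycleComp H C = ∀ v → C v ≡ true → deg H v ≡ 2

IsPathComp : ∀ {n} → ESet n → VSet n → Set
IsPathComp H C = ¬ IsCycleComp H C

Inner : ∀ {n} → ESet n → Fin n → Set
Inner H v = deg H v ≡ 2

Endpoint : ∀ {n} → ESet n → Fin n → Set
Endpoint H v = ¬ (deg H v ≡ 2)

InnerOfPath : ∀ {n} → ESet n → ℕ → Fin n → Set
InnerOfPath H minLen w = ∃ λ C' →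
  IsComp H C' × IsPathComp H C' × minLen ≤ compEdges H C' × C' w ≡ true × Inner H w

JoinsPath : ∀ {n} → ESet n → VSet n → VSet n → ESet n → Set
JoinsPath H C D ET =
  (∀ v → C v ≡ true → D v ≡ true) ×
  (∀ a b → C a ≡ true → H a b ≡ true → ET a b ≡ true)

JoinsCycle : ∀ {n} → ESet n → VSet n → VSet n → ESet n → Set
JoinsCycle H C D ET =
  (∀ v → C v ≡ true → D v ≡ true) ×
  (compEdges H C ≤ edgeCount (λ a b → restrictE C H a b ∧ ET a b) + 1)

Joins : ∀ {n} → ESet n → VSet n → VSet n → ESet n → Set
Joins H C D ET =
  (IsPathComp H C × JoinsPath H C D ET) ⊎ (IsCycleComp H C × JoinsCycle H C D ET)

internal : ∀ {n} → VSet n → ESet n → ℕ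
internal D ET = count (λ v → D v ∧ ⌊ 2 ≤? deg ET v ⌋)

JoinEdgeSet : ∀ {n} → ESet n → VSet n → ESet n → ESet n → Set
JoinEdgeSet H D ET S = ∀ a b →
  (S a b ≡ true → H a b ≡ true × (∃ λ C → IsComp H C × C a ≡ true × Joins H C D ET)) ×
  (H a b ≡ true × (∃ λ C → IsComp H C × C a ≡ true × Joins H C D ET) → S a b ≡ true)

ThreeQuarterApprox : ∀ {n} → ESet n → VSet n → ESet n → Set
ThreeQuarterApprox H D ET = ∃ λ S → JoinEdgeSet H D ET S × 3 * edgeCount S ≤ 4 * internal D ET

-- The forest is a single spanning tree T of G, grown greedily (Kruskal) from the edges of H
-- without one "break" edge per cycle, then "links", then the other edges of G, then the breaks.
-- The non-break edges of H form a forest and are all accepted. A link joins an endpoint of a path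
-- with 1 to 3 edges to an inner vertex of a path with at least 4 edges; some link of every short
-- path is accepted, which makes that endpoint internal. The break of a cycle is taken at its
-- anchor, the least vertex with an edge leaving the cycle in an auxiliary greedy tree T₀ that
-- starts from all of H; this exit edge survives in T, so the anchor stays internal and a cycle
-- with c ≥ 4 vertices has at least c - 1 internal vertices. Weighing each vertex v by 3 deg_H(v)
-- against 8 [v internal in T], component by component (paths with ℓ ≥ 4 edges have ℓ - 1
-- internal vertices, shorter paths ℓ, cycles c - 1), gives 3 |E(H)| ≤ 4 (internal vertices).

module Submission where

open import Defs hiding (sym)
open import Data.Nat using (ℕ; zero; suc; _+_; _*_; _≤_; _<_; _≤?_; z≤n; s≤s; s≤s⁻¹)
import Data.Nat as N
open import Data.Nat.Properties
open import Algebra.Properties.CommutativeSemigroup +-commutativeSemigroup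
  using () renaming (interchange to +-interchange; x∙yz≈y∙xz to +-exchange)
open import Data.Nat.Tactic.RingSolver using (solve-∀)
open import Data.Bool using (Bool; true; false; _∧_; _∨_; not; if_then_else_)
import Data.Bool.Properties as BP
open import Data.Fin using (Fin; zero; suc; inject₁; fromℕ) renaming (_<_ to _<F_)
import Data.Fin.Properties as FinP
open import Data.Product using (Σ; ∃; _×_; _,_; proj₁; proj₂)
open import Data.Sum using (_⊎_; inj₁; inj₂)
open import Data.Empty using (⊥; ⊥-elim)
open import Data.Unit using (⊤; tt)
open import Data.List using (List; []; _∷_; length; _++_)
open import Data.List.Relation.Unary.Any using (here; there; any?)
open import Data.List.Membership.Propositional using (_∈_)
open import Data.List.Membership.Propositional.Properties using (∈-++⁺ˡ; ∈-++⁺ʳ; ∈-++⁻)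
open import Function using (_∘_)
open import Relation.Nullary using (¬_; Dec; yes; no)
open import Relation.Nullary.Decidable using (⌊_⌋)
open import Relation.Binary using (tri<; tri≈; tri>)
open import Relation.Binary.PropositionalEquality

private variable n : ℕ

∨-true⁻ : ∀ {a b} → a ∨ b ≡ true → a ≡ true ⊎ b ≡ true
∨-true⁻ {true}  _ = inj₁ refl
∨-true⁻ {false} p = inj₂ p

∨-trueˡ : ∀ {a} b → a ≡ true → a ∨ b ≡ true
∨-trueˡ _ refl = refl

∨-trueʳ : ∀ a {b} → b ≡ true → a ∨ b ≡ true
∨-trueʳ true  _ = refl
∨-trueʳ false p = p

∧-trueˡ : ∀ {a b} → a ∧ b ≡ true → a ≡ true
∧-trueˡ {true} _ = refl

∧-trueʳ : ∀ {a b} → a ∧ b ≡ true → b ≡ true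
∧-trueʳ {true} p = p

∧-true⁺ : ∀ {a b} → a ≡ true → b ≡ true → a ∧ b ≡ true
∧-true⁺ refl refl = refl

not-true⁻ : ∀ {a} → not a ≡ true → a ≡ false
not-true⁻ {false} _ = refl

not-true⁺ : ∀ {a} → a ≡ false → not a ≡ true
not-true⁺ refl = refl

true≢false : ∀ {a} → a ≡ true → a ≡ false → ⊥
true≢false refl ()

¬true⇒false : ∀ {a} → ¬ a ≡ true → a ≡ false
¬true⇒false {true}  p = ⊥-elim (p refl)
¬true⇒false {false} _ = refl

bool-ext : ∀ {a b} → (a ≡ true → b ≡ true) → (b ≡ true → a ≡ true) → a ≡ b
bool-ext {true}  {true}  _ _ = refl
bool-ext {true}  {false} f _ = sym (f refl)
bool-ext {false} {true}  _ g = g refl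
bool-ext {false} {false} _ _ = refl

⌊⌋-true⁺ : ∀ {A : Set} (d : Dec A) → A → ⌊ d ⌋ ≡ true
⌊⌋-true⁺ (yes _) _ = refl
⌊⌋-true⁺ (no ¬a) a = ⊥-elim (¬a a)

⌊⌋-false⁺ : ∀ {A : Set} (d : Dec A) → ¬ A → ⌊ d ⌋ ≡ false
⌊⌋-false⁺ (yes a) ¬a = ⊥-elim (¬a a)
⌊⌋-false⁺ (no _)  _  = refl

⌊⌋-true⁻ : ∀ {A : Set} (d : Dec A) → ⌊ d ⌋ ≡ true → A
⌊⌋-true⁻ (yes a) _ = a

eqF-refl : ∀ (a : Fin n) → eqF a a ≡ true
eqF-refl a = ⌊⌋-true⁺ (a FinP.≟ a) refl

eqF-false⁺ : ∀ {a b : Fin n} → ¬ a ≡ b → eqF a b ≡ false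
eqF-false⁺ {a = a} {b} = ⌊⌋-false⁺ (a FinP.≟ b)

eqF-true⁻ : ∀ {a b : Fin n} → eqF a b ≡ true → a ≡ b
eqF-true⁻ {a = a} {b} = ⌊⌋-true⁻ (a FinP.≟ b)

eqF-suc : ∀ (i j : Fin n) → eqF (suc i) (suc j) ≡ eqF i j
eqF-suc i j = bool-ext
  (λ p → subst (λ k → eqF i k ≡ true) (FinP.suc-injective (eqF-true⁻ p)) (eqF-refl i))
  (λ p → subst (λ k → eqF (suc i) (suc k) ≡ true) (eqF-true⁻ p) (eqF-refl (suc i)))

ltF-true⁺ : ∀ {i j : Fin n} → i <F j → ltF i j ≡ true
ltF-true⁺ {i = i} {j} = ⌊⌋-true⁺ (i FinP.<? j)

ltF-false⁺ : ∀ {i j : Fin n} → ¬ i <F j → ltF i j ≡ false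
ltF-false⁺ {i = i} {j} = ⌊⌋-false⁺ (i FinP.<? j)

ltF-true⁻ : ∀ {i j : Fin n} → ltF i j ≡ true → i <F j
ltF-true⁻ {i = i} {j} = ⌊⌋-true⁻ (i FinP.<? j)

ltF-connex : ∀ {i j : Fin n} → ¬ i ≡ j → ltF i j ∨ ltF j i ≡ true
ltF-connex {i = i} {j} i≢j with FinP.<-cmp i j
... | tri< i<j _ _ = ∨-trueˡ (ltF j i) (ltF-true⁺ i<j)
... | tri≈ _ i≡j _ = ⊥-elim (i≢j i≡j)
... | tri> _ _ j<i = ∨-trueʳ (ltF i j) (ltF-true⁺ j<i)

ltF-asym : ∀ (i j : Fin n) → ltF i j ∧ ltF j i ≡ false
ltF-asym i j with FinP.<-cmp i j
... | tri< i<j _ j≮i rewrite ltF-false⁺ j≮i = BP.∧-zeroʳ (ltF i j)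
... | tri≈ i≮j _ _   rewrite ltF-false⁺ i≮j = refl
... | tri> i≮j _ _   rewrite ltF-false⁺ i≮j = refl

ltF-false⇒≡ : ∀ (i j : Fin n) → ltF i j ≡ false → ltF j i ≡ false → i ≡ j
ltF-false⇒≡ i j p q with FinP.<-cmp i j
... | tri< i<j _ _ = ⊥-elim (true≢false (ltF-true⁺ i<j) p)
... | tri≈ _ i≡j _ = i≡j
... | tri> _ _ j<i = ⊥-elim (true≢false (ltF-true⁺ j<i) q)

ind : Bool → ℕ
ind b = if b then 1 else 0

ind-mono : ∀ {a b} → (a ≡ true → b ≡ true) → ind a ≤ ind b
ind-mono {false} _ = z≤n
ind-mono {true}  f rewrite f refl = ≤-refl

count-cong : ∀ {f g : Fin n → Bool} → (∀ i → f i ≡ g i) → count f ≡ count g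
count-cong {zero}          _ = refl
count-cong {suc n} {f} {g} e rewrite e zero = cong (ind (g zero) +_) (count-cong (e ∘ suc))

count-mono : ∀ {f g : Fin n → Bool} → (∀ i → f i ≡ true → g i ≡ true) → count f ≤ count g
count-mono {zero}  _ = z≤n
count-mono {suc n} e = +-mono-≤ (ind-mono (e zero)) (count-mono (e ∘ suc))

count≤n : ∀ (f : Fin n → Bool) → count f ≤ n
count≤n {zero}  f = z≤n
count≤n {suc n} f with f zero
... | true  = s≤s (count≤n (f ∘ suc))
... | false = m≤n⇒m≤1+n (count≤n (f ∘ suc))

count-none : ∀ (f : Fin n → Bool) → (∀ i → f i ≡ false) → count f ≡ 0
count-none {zero}  f e = refl
count-none {suc n} f e rewrite e zero = count-none (f ∘ suc) (e ∘ suc)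

count>0⇒∃ : ∀ (f : Fin n → Bool) → 0 < count f → ∃ λ i → f i ≡ true
count>0⇒∃ {suc n} f p with f zero in eq
... | true  = zero , eq
... | false with count>0⇒∃ (f ∘ suc) p
... | i , q = suc i , q

remove : (Fin n → Bool) → Fin n → Fin n → Bool
remove f i j = f j ∧ not (eqF j i)

remove-true : ∀ (f : Fin n → Bool) {i j} → f j ≡ true → ¬ j ≡ i → remove f i j ≡ true
remove-true f p j≢i rewrite p | eqF-false⁺ j≢i = refl

remove-≢ : ∀ (f : Fin n → Bool) {i j} → remove f i j ≡ true → ¬ j ≡ i
remove-≢ f {i} p refl rewrite eqF-refl i = true≢false (∧-trueʳ p) refl

count-remove : ∀ (f : Fin n → Bool) i → count f ≡ ind (f i) + count (remove f i)
count-remove {suc n} f zero rewrite BP.∧-zeroʳ (f zero) =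
  cong (ind (f zero) +_) (count-cong (λ j → sym (BP.∧-identityʳ (f (suc j)))))
count-remove {suc n} f (suc i) = begin
  ind (f zero) + count (f ∘ suc)
    ≡⟨ cong (ind (f zero) +_) (count-remove (f ∘ suc) i) ⟩
  ind (f zero) + (ind (f (suc i)) + count (remove (f ∘ suc) i))
    ≡⟨ +-exchange (ind (f zero)) (ind (f (suc i))) _ ⟩
  ind (f (suc i)) + (ind (f zero) + count (remove (f ∘ suc) i))
    ≡⟨ cong (ind (f (suc i)) +_) (cong₂ _+_ (cong ind (sym (BP.∧-identityʳ (f zero)))) (count-cong shift)) ⟩
  ind (f (suc i)) + count (remove f (suc i)) ∎
  where
  open ≡-Reasoning
  shift : ∀ j → remove (f ∘ suc) i j ≡ remove f (suc i) (suc j)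
  shift j = cong (λ b → f (suc j) ∧ not b) (sym (eqF-suc j i))

count-remove-true : ∀ (f : Fin n → Bool) i → f i ≡ true → count f ≡ suc (count (remove f i))
count-remove-true f i p rewrite count-remove f i | p = refl

count≥1 : ∀ (f : Fin n → Bool) i → f i ≡ true → 1 ≤ count f
count≥1 f i p rewrite count-remove-true f i p = s≤s z≤n

count≥2 : ∀ (f : Fin n → Bool) i j → f i ≡ true → f j ≡ true → ¬ i ≡ j → 2 ≤ count f
count≥2 f i j p q i≢j rewrite count-remove-true f i p =
  s≤s (count≥1 (remove f i) j (remove-true f q (i≢j ∘ sym)))

count≥3 : ∀ (f : Fin n → Bool) i j k → f i ≡ true → f j ≡ true → f k ≡ true →
  ¬ i ≡ j → ¬ i ≡ k → ¬ j ≡ k → 3 ≤ count f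
count≥3 f i j k p q r i≢j i≢k j≢k rewrite count-remove-true f i p =
  s≤s (count≥2 (remove f i) j k (remove-true f q (i≢j ∘ sym)) (remove-true f r (i≢k ∘ sym)) j≢k)

count-< : ∀ {f g : Fin n → Bool} → (∀ i → f i ≡ true → g i ≡ true) →
  ∀ r → g r ≡ true → f r ≡ false → count f < count g
count-< {f = f} {g} f⊆g r gr fr rewrite count-remove f r | count-remove g r | gr | fr =
  s≤s (count-mono (λ i p → ∧-true⁺ (f⊆g i (∧-trueˡ p)) (∧-trueʳ p)))

count≥3⇒three : ∀ (f : Fin n → Bool) → 3 ≤ count f →
  ∃ λ i → ∃ λ j → ∃ λ k → f i ≡ true × f j ≡ true × f k ≡ true × ¬ i ≡ j × ¬ i ≡ k × ¬ j ≡ k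
count≥3⇒three f 3≤f =
  let (i , fi) = count>0⇒∃ f (≤-trans (s≤s z≤n) 3≤f)
      2≤f-i = ≤-pred (subst (3 ≤_) (count-remove-true f i fi) 3≤f)
      (j , fj) = count>0⇒∃ (remove f i) (≤-trans (s≤s z≤n) 2≤f-i)
      1≤f-i-j = ≤-pred (subst (2 ≤_) (count-remove-true (remove f i) j fj) 2≤f-i)
      (k , fk) = count>0⇒∃ (remove (remove f i) j) 1≤f-i-j
  in i , j , k , fi , ∧-trueˡ fj , ∧-trueˡ (∧-trueˡ fk) ,
     remove-≢ f fj ∘ sym , remove-≢ f (∧-trueˡ fk) ∘ sym , remove-≢ (remove f i) fk ∘ sym

count-eqF : ∀ (x : Fin n) → count (λ v → eqF v x) ≡ 1
count-eqF x = trans (count-remove _ x) (cong₂ _+_ (cong ind (eqF-refl x)) (count-none _ only-x))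
  where
  only-x : ∀ j → remove (λ v → eqF v x) x j ≡ false
  only-x j with eqF j x
  ... | true  = refl
  ... | false = refl

count-∨-disjoint : ∀ (f g : Fin n → Bool) → (∀ i → f i ∧ g i ≡ false) →
  count (λ i → f i ∨ g i) ≡ count f + count g
count-∨-disjoint {zero}  f g d = refl
count-∨-disjoint {suc n} f g d
  rewrite count-∨-disjoint (f ∘ suc) (g ∘ suc) (d ∘ suc) = head (f zero) (g zero) (d zero)
  where
  head : ∀ a b → a ∧ b ≡ false →
    ind (a ∨ b) + (count (f ∘ suc) + count (g ∘ suc)) ≡ ind a + count (f ∘ suc) + (ind b + count (g ∘ suc))
  head false false _ = refl
  head false true  _ = sym (+-suc _ _)
  head true  false _ = refl

count-∨ : ∀ (f g : Fin n → Bool) → count (λ i → f i ∨ g i) ≤ count f + count g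
count-∨ {zero}  f g = z≤n
count-∨ {suc n} f g = ≤-trans (+-monoʳ-≤ (ind (f zero ∨ g zero)) (count-∨ (f ∘ suc) (g ∘ suc))) (head (f zero) (g zero))
  where
  head : ∀ a b → ind (a ∨ b) + (count (f ∘ suc) + count (g ∘ suc)) ≤ ind a + count (f ∘ suc) + (ind b + count (g ∘ suc))
  head false b     = ≤-reflexive (sym (+-exchange (count (f ∘ suc)) (ind b) _))
  head true  false = ≤-refl
  head true  true  = s≤s (+-monoʳ-≤ (count (f ∘ suc)) (m≤n+m (count (g ∘ suc)) 1))

count-∧-eqF : ∀ c (x : Fin n) → count (λ t → c ∧ eqF t x) ≡ ind c
count-∧-eqF true  x = count-eqF x
count-∧-eqF false x = count-none (λ t → false ∧ eqF t x) (λ _ → refl)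

count-insert : ∀ (f : Fin n → Bool) i → f i ≡ false → count (λ j → f j ∨ eqF j i) ≡ suc (count f)
count-insert f i fi≡false = begin
  count (λ j → f j ∨ eqF j i) ≡⟨ count-∨-disjoint f (λ j → eqF j i) disjoint ⟩
  count f + count (λ j → eqF j i) ≡⟨ cong (count f +_) (count-eqF i) ⟩
  count f + 1                     ≡⟨ +-comm (count f) 1 ⟩
  suc (count f)                   ∎
  where
  open ≡-Reasoning
  disjoint : ∀ j → f j ∧ eqF j i ≡ false
  disjoint j with j FinP.≟ i
  ... | yes refl = trans (BP.∧-identityʳ (f j)) fi≡false
  ... | no _     = BP.∧-zeroʳ (f j)

sumF-cong : ∀ {f g : Fin n → ℕ} → (∀ i → f i ≡ g i) → sumF f ≡ sumF g
sumF-cong {zero}  e = refl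
sumF-cong {suc n} e = cong₂ _+_ (e zero) (sumF-cong (e ∘ suc))

sumF-mono : ∀ {f g : Fin n → ℕ} → (∀ i → f i ≤ g i) → sumF f ≤ sumF g
sumF-mono {zero}  e = z≤n
sumF-mono {suc n} e = +-mono-≤ (e zero) (sumF-mono (e ∘ suc))

sumF-+ : ∀ (f g : Fin n → ℕ) → sumF (λ i → f i + g i) ≡ sumF f + sumF g
sumF-+ {zero}  f g = refl
sumF-+ {suc n} f g rewrite sumF-+ (f ∘ suc) (g ∘ suc) = +-interchange (f zero) (g zero) _ _

sumF-* : ∀ k (f : Fin n → ℕ) → sumF (λ i → k * f i) ≡ k * sumF f
sumF-* {zero}  k f = sym (*-zeroʳ k)
sumF-* {suc n} k f rewrite sumF-* k (f ∘ suc) = sym (*-distribˡ-+ k (f zero) _)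

sumF-zero : ∀ (f : Fin n → ℕ) → (∀ i → f i ≡ 0) → sumF f ≡ 0
sumF-zero {zero}  f e = refl
sumF-zero {suc n} f e rewrite e zero = sumF-zero (f ∘ suc) (e ∘ suc)

sumF>0⇒∃ : ∀ (f : Fin n → ℕ) → 0 < sumF f → ∃ λ i → 0 < f i
sumF>0⇒∃ {suc n} f p with f zero in eq
... | suc _ = zero , subst (0 <_) (sym eq) (s≤s z≤n)
... | zero with sumF>0⇒∃ (f ∘ suc) p
... | i , q = suc i , q

sumF-swap : ∀ {m n} (h : Fin m → Fin n → ℕ) →
  sumF (λ i → sumF (λ j → h i j)) ≡ sumF (λ j → sumF (λ i → h i j))
sumF-swap {zero}  {n} h = sym (sumF-zero {n} _ (λ _ → refl))
sumF-swap {suc m}     h rewrite sumF-swap (h ∘ suc) = sym (sumF-+ (h zero) (λ j → sumF (λ i → h (suc i) j)))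

count≡sumF-ind : ∀ (f : Fin n → Bool) → count f ≡ sumF (ind ∘ f)
count≡sumF-ind {zero}  f = refl
count≡sumF-ind {suc n} f = cong (ind (f zero) +_) (count≡sumF-ind (f ∘ suc))

Undirected : ESet n → Set
Undirected E = ∀ u v → E u v ≡ E v u

Loopless : ESet n → Set
Loopless E = ∀ v → E v v ≡ false

_⊆ᴱ_ : ESet n → ESet n → Set
E ⊆ᴱ K = ∀ a b → E a b ≡ true → K a b ≡ true

infix 4 _⊆ᴱ_

MaxDegree : ℕ → ESet n → Set
MaxDegree k E = ∀ v → deg E v ≤ k

deg-mono : ∀ {E E' : ESet n} v → (∀ t → E v t ≡ true → E' v t ≡ true) → deg E v ≤ deg E' v
deg-mono v = count-mono

deg-split : ∀ (E : ESet n) i → E i i ≡ false →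
  deg E i ≡ count (λ j → E i j ∧ ltF i j) + count (λ j → E i j ∧ ltF j i)
deg-split E i noLoop = trans (count-cong split) (count-∨-disjoint _ _ disjoint)
  where
  split : ∀ j → E i j ≡ (E i j ∧ ltF i j) ∨ (E i j ∧ ltF j i)
  split j with i FinP.≟ j
  ... | yes refl rewrite noLoop = refl
  ... | no i≢j rewrite sym (BP.∧-distribˡ-∨ (E i j) (ltF i j) (ltF j i)) | ltF-connex i≢j =
    sym (BP.∧-identityʳ (E i j))
  disjoint : ∀ j → (E i j ∧ ltF i j) ∧ (E i j ∧ ltF j i) ≡ false
  disjoint j with E i j
  ... | true  = ltF-asym i j
  ... | false = refl

handshake : ∀ (E : ESet n) → Undirected E → Loopless E → sumF (deg E) ≡ 2 * edgeCount E
handshake {n} E undirected loopless = begin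
  sumF (deg E)
    ≡⟨ sumF-cong (λ i → deg-split E i (loopless i)) ⟩
  sumF (λ i → count (λ j → E i j ∧ ltF i j) + count (λ j → E i j ∧ ltF j i))
    ≡⟨ sumF-+ (λ i → count (λ j → E i j ∧ ltF i j)) (λ i → count (λ j → E i j ∧ ltF j i)) ⟩
  edgeCount E + sumF (λ i → count (λ j → E i j ∧ ltF j i))
    ≡⟨ cong (edgeCount E +_) downward ⟩
  edgeCount E + edgeCount E
    ≡⟨ cong (edgeCount E +_) (sym (+-identityʳ _)) ⟩
  2 * edgeCount E ∎
  where
  open ≡-Reasoning
  downward : sumF (λ i → count (λ j → E i j ∧ ltF j i)) ≡ edgeCount E
  downward = begin
    sumF (λ i → count (λ j → E i j ∧ ltF j i))
      ≡⟨ sumF-cong (λ i → count≡sumF-ind (λ j → E i j ∧ ltF j i)) ⟩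
    sumF (λ i → sumF (λ j → ind (E i j ∧ ltF j i)))
      ≡⟨ sumF-swap {n} {n} _ ⟩
    sumF (λ j → sumF (λ i → ind (E i j ∧ ltF j i)))
      ≡⟨ sumF-cong (λ j → sumF-cong (λ i → cong (λ x → ind (x ∧ ltF j i)) (undirected i j))) ⟩
    sumF (λ j → sumF (λ i → ind (E j i ∧ ltF j i)))
      ≡⟨ sumF-cong (λ j → count≡sumF-ind (λ i → E j i ∧ ltF j i)) ⟨
    edgeCount E ∎

edgeCount-cong : ∀ {E E' : ESet n} → (∀ a b → E a b ≡ E' a b) → edgeCount E ≡ edgeCount E'
edgeCount-cong e = sumF-cong (λ i → count-cong (λ j → cong (_∧ ltF i j) (e i j)))

edgeCount-mono : ∀ {E E' : ESet n} → E ⊆ᴱ E' → edgeCount E ≤ edgeCount E'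
edgeCount-mono E⊆E' = sumF-mono (λ i → count-mono (λ j p → ∧-true⁺ (E⊆E' i j (∧-trueˡ p)) (∧-trueʳ p)))

restrictE-undirected : ∀ (W : VSet n) {E} → Undirected E → Undirected (restrictE W E)
restrictE-undirected W {E} undirected a b
  rewrite undirected a b | sym (BP.∧-assoc (W a) (W b) (E b a)) | BP.∧-comm (W a) (W b) =
  BP.∧-assoc (W b) (W a) (E b a)

restrictE-loopless : ∀ (W : VSet n) {E} → Loopless E → Loopless (restrictE W E)
restrictE-loopless W {E} loopless v rewrite loopless v | BP.∧-zeroʳ (W v) = BP.∧-zeroʳ (W v)

deleteEdge : ESet n → Fin n → Fin n → ESet n
deleteEdge E a b x y = E x y ∧ not ((eqF x a ∧ eqF y b) ∨ (eqF x b ∧ eqF y a))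

deleteEdge-⊆ : ∀ (E : ESet n) a b x y → deleteEdge E a b x y ≡ true → E x y ≡ true
deleteEdge-⊆ E a b x y p = ∧-trueˡ p

deleteEdge-undirected : ∀ (E : ESet n) a b → Undirected E → Undirected (deleteEdge E a b)
deleteEdge-undirected E a b sy x y rewrite sy x y
  | BP.∧-comm (eqF x a) (eqF y b) | BP.∧-comm (eqF x b) (eqF y a)
  | BP.∨-comm (eqF y b ∧ eqF x a) (eqF y a ∧ eqF x b) = refl

deleteEdge-removes : ∀ (E : ESet n) a b → deleteEdge E a b a b ≡ false
deleteEdge-removes E a b rewrite eqF-refl a | eqF-refl b = BP.∧-zeroʳ (E a b)

deleteEdge-removes′ : ∀ (E : ESet n) a b → deleteEdge E a b b a ≡ false
deleteEdge-removes′ E a b rewrite eqF-refl a | eqF-refl b | BP.∨-zeroʳ (eqF b a ∧ eqF a b) = BP.∧-zeroʳ (E b a)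

deg-deleteEdge : ∀ (E : ESet n) a b v → deg E v ≤ deg (deleteEdge E a b) v + ind (eqF v a) + ind (eqF v b)
deg-deleteEdge E a b v = begin
  count (E v)                                         ≤⟨ count-mono kept-or-deleted ⟩
  count (λ t → (deleteEdge E a b v t ∨ atA t) ∨ atB t) ≤⟨ count-∨ _ atB ⟩
  count (λ t → deleteEdge E a b v t ∨ atA t) + count atB
    ≤⟨ +-monoˡ-≤ (count atB) (count-∨ (deleteEdge E a b v) atA) ⟩
  count (deleteEdge E a b v) + count atA + count atB  ≡⟨ cong₂ (λ x y → count (deleteEdge E a b v) + x + y)
                                                           (count-∧-eqF (eqF v a) b) (count-∧-eqF (eqF v b) a) ⟩
  deg (deleteEdge E a b) v + ind (eqF v a) + ind (eqF v b) ∎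
  where
  open ≤-Reasoning
  atA atB : Fin _ → Bool
  atA t = eqF v a ∧ eqF t b
  atB t = eqF v b ∧ eqF t a
  kept-or-deleted : ∀ t → E v t ≡ true → (deleteEdge E a b v t ∨ atA t) ∨ atB t ≡ true
  kept-or-deleted t e rewrite e with atA t | atB t
  ... | false | false = refl
  ... | false | true  = refl
  ... | true  | _     = refl

-- Deleting one edge lowers the degree sum by at most two.
edgeCount-deleteEdge : ∀ (E : ESet n) → Undirected E → Loopless E → ∀ a b →
  edgeCount E ≤ edgeCount (deleteEdge E a b) + 1
edgeCount-deleteEdge E undirected loopless a b = *-cancelˡ-≤ 2 (begin
  2 * edgeCount E                                     ≡⟨ handshake E undirected loopless ⟨
  sumF (deg E)                                        ≤⟨ sumF-mono (deg-deleteEdge E a b) ⟩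
  sumF (λ v → deg E' v + ind (eqF v a) + ind (eqF v b))
    ≡⟨ trans (sumF-+ (λ v → deg E' v + ind (eqF v a)) (λ v → ind (eqF v b)))
             (cong₂ _+_ (sumF-+ (deg E') (λ v → ind (eqF v a))) (once b)) ⟩
  sumF (deg E') + sumF (λ v → ind (eqF v a)) + 1       ≡⟨ cong₂ (λ x y → x + y + 1) (handshake E' undirected′ loopless′) (once a) ⟩
  2 * edgeCount E' + 1 + 1                            ≡⟨ shuffle (edgeCount E') ⟩
  2 * (edgeCount E' + 1)                              ∎)
  where
  open ≤-Reasoning
  E' = deleteEdge E a b
  undirected′ : Undirected E'
  undirected′ = deleteEdge-undirected E a b undirected
  loopless′ : Loopless E'
  loopless′ v rewrite loopless v = refl
  once : ∀ x → sumF (λ v → ind (eqF v x)) ≡ 1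
  once x = trans (sym (count≡sumF-ind (λ v → eqF v x))) (count-eqF x)
  shuffle : ∀ e → 2 * e + 1 + 1 ≡ 2 * (e + 1)
  shuffle = solve-∀

sumIn : VSet n → (Fin n → ℕ) → ℕ
sumIn W f = sumF (λ v → if W v then f v else 0)

countIn : VSet n → (Fin n → Bool) → ℕ
countIn W g = count (λ v → W v ∧ g v)

sumIn-cong : ∀ (W : VSet n) {f g : Fin n → ℕ} → (∀ v → W v ≡ true → f v ≡ g v) → sumIn W f ≡ sumIn W g
sumIn-cong W {f} {g} e = sumF-cong pointwise
  where
  pointwise : ∀ v → (if W v then f v else 0) ≡ (if W v then g v else 0)
  pointwise v with W v in wv
  ... | true  = e v wv
  ... | false = refl

sumIn-ind : ∀ (W : VSet n) (g : Fin n → Bool) → sumIn W (ind ∘ g) ≡ countIn W g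
sumIn-ind W g = trans (sumF-cong pointwise) (sym (count≡sumF-ind (λ v → W v ∧ g v)))
  where
  pointwise : ∀ v → (if W v then ind (g v) else 0) ≡ ind (W v ∧ g v)
  pointwise v with W v
  ... | true  = refl
  ... | false = refl

sumIn-* : ∀ (W : VSet n) k (f : Fin n → ℕ) → sumIn W (λ v → k * f v) ≡ k * sumIn W f
sumIn-* W k f = trans (sumF-cong pointwise) (sumF-* k (λ v → if W v then f v else 0))
  where
  pointwise : ∀ v → (if W v then k * f v else 0) ≡ k * (if W v then f v else 0)
  pointwise v with W v
  ... | true  = refl
  ... | false = sym (*-zeroʳ k)

sumIn-+ : ∀ (W : VSet n) (f g : Fin n → ℕ) → sumIn W (λ v → f v + g v) ≡ sumIn W f + sumIn W g
sumIn-+ W f g = trans (sumF-cong pointwise) (sumF-+ (λ v → if W v then f v else 0) (λ v → if W v then g v else 0))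
  where
  pointwise : ∀ v → (if W v then f v + g v else 0) ≡ (if W v then f v else 0) + (if W v then g v else 0)
  pointwise v with W v
  ... | true  = refl
  ... | false = refl

sumIn-split : ∀ (W C : VSet n) (f : Fin n → ℕ) → (∀ v → C v ≡ true → W v ≡ true) →
  sumIn W f ≡ sumIn C f + sumIn (λ v → W v ∧ not (C v)) f
sumIn-split W C f C⊆W = trans (sumF-cong pointwise) (sumF-+ (λ v → if C v then f v else 0) _)
  where
  pointwise : ∀ v → (if W v then f v else 0) ≡ (if C v then f v else 0) + (if W v ∧ not (C v) then f v else 0)
  pointwise v with C v in cv | W v in wv
  ... | true  | true  = sym (+-identityʳ _)
  ... | true  | false = ⊥-elim (true≢false (C⊆W v cv) wv)
  ... | false | true  = refl
  ... | false | false = refl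

sumIn-empty : ∀ (W : VSet n) (f : Fin n → ℕ) → (∀ v → W v ≡ false) → sumIn W f ≡ 0
sumIn-empty W f empty = sumF-zero _ nothing
  where
  nothing : ∀ v → (if W v then f v else 0) ≡ 0
  nothing v rewrite empty v = refl

restrictE-full : ∀ (W : VSet n) (E : ESet n) → (∀ v → W v ≡ true) → ∀ a b → restrictE W E a b ≡ E a b
restrictE-full W E full a b rewrite full a | full b = refl

_++ʷ_ : ∀ {E : ESet n} {x y z} → Walk E x y → Walk E y z → Walk E x z
here       ++ʷ w′ = w′
step e w   ++ʷ w′ = step e (w ++ʷ w′)

walk-map : ∀ {E E' : ESet n} → E ⊆ᴱ E' → ∀ {x y} → Walk E x y → Walk E' x y
walk-map E⊆E' here       = here
walk-map E⊆E' (step e w) = step (E⊆E' _ _ e) (walk-map E⊆E' w)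

walk-refine : ∀ {E E' : ESet n} → (∀ a b → E' a b ≡ true → Walk E a b) → ∀ {x y} → Walk E' x y → Walk E x y
walk-refine edge here       = here
walk-refine edge (step e w) = edge _ _ e ++ʷ walk-refine edge w

walk-reverse : ∀ {E : ESet n} → Undirected E → ∀ {x y} → Walk E x y → Walk E y x
walk-reverse undirected here                = here
walk-reverse undirected (step {u} {w} e ws) = walk-reverse undirected ws ++ʷ step (trans (undirected w u) e) here

walk-first-edge : ∀ {E : ESet n} {x y} → Walk E x y → ¬ x ≡ y → ∃ λ t → E x t ≡ true
walk-first-edge here               x≢x = ⊥-elim (x≢x refl)
walk-first-edge (step {w = w} e _) _   = w , e

Closed : ESet n → VSet n → Set
Closed E W = ∀ a b → W a ≡ true → E a b ≡ true → W b ≡ true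

walk-stays : ∀ {E : ESet n} {W} → Closed E W → ∀ {x y} → W x ≡ true → Walk E x y → W y ≡ true
walk-stays closed Wx here       = Wx
walk-stays closed Wx (step e w) = walk-stays closed (closed _ _ Wx e) w

Respects : ESet n → VSet n → Set
Respects E C = ∀ a b → E a b ≡ true → C a ≡ C b

walk-respects : ∀ {E : ESet n} {C} → Respects E C → ∀ {x y} → Walk E x y → C x ≡ C y
walk-respects respects here       = refl
walk-respects respects (step e w) = trans (respects _ _ e) (walk-respects respects w)

walk-leaves : ∀ {E : ESet n} (W : VSet n) {x y} → Walk E x y → W x ≡ true → W y ≡ false →
  ∃ λ a → ∃ λ b → W a ≡ true × W b ≡ false × E a b ≡ true
walk-leaves W here Wx Wy = ⊥-elim (true≢false Wx Wy)
walk-leaves W (step {u} {w} e ws) Wu Wy with W w in Ww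
... | true  = walk-leaves W ws Ww Wy
... | false = u , w , Wu , Ww , e

walk-along : ∀ (E : ESet n) N (g : Fin (suc N) → Fin n) →
  (∀ (i : Fin N) → E (g (inject₁ i)) (g (suc i)) ≡ true) → Walk E (g zero) (g (fromℕ N))
walk-along E zero    g edges = here
walk-along E (suc N) g edges = step (edges zero) (walk-along E N (g ∘ suc) (edges ∘ suc))

vertices : ∀ {E : ESet n} {x y} → Walk E x y → List (Fin n)
vertices {x = x} here       = x ∷ []
vertices {x = x} (step e w) = x ∷ vertices w

walk-length : ∀ {E : ESet n} {x y} → Walk E x y → ℕ
walk-length here       = 0
walk-length (step e w) = suc (walk-length w)

length-vertices : ∀ {E : ESet n} {x y} (w : Walk E x y) → length (vertices w) ≡ suc (walk-length w)
length-vertices here       = refl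
length-vertices (step e w) = cong suc (length-vertices w)

first∈vertices : ∀ {E : ESet n} {x y} (w : Walk E x y) → x ∈ vertices w
first∈vertices here       = here refl
first∈vertices (step e w) = here refl

last∈vertices : ∀ {E : ESet n} {x y} (w : Walk E x y) → y ∈ vertices w
last∈vertices here       = here refl
last∈vertices (step e w) = there (last∈vertices w)

Distinct : List (Fin n) → Set
Distinct []       = ⊤
Distinct (x ∷ xs) = ¬ x ∈ xs × Distinct xs

memberᵇ : Fin n → List (Fin n) → Bool
memberᵇ v []       = false
memberᵇ v (x ∷ xs) = eqF v x ∨ memberᵇ v xs

memberᵇ-true⁺ : ∀ {v : Fin n} {xs} → v ∈ xs → memberᵇ v xs ≡ true
memberᵇ-true⁺ {v = v} (here refl)           = ∨-trueˡ _ (eqF-refl v)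
memberᵇ-true⁺ {v = v} {x ∷ xs} (there v∈xs) = ∨-trueʳ (eqF v x) (memberᵇ-true⁺ v∈xs)

memberᵇ-true⁻ : ∀ {v : Fin n} xs → memberᵇ v xs ≡ true → v ∈ xs
memberᵇ-true⁻ {v = v} (x ∷ xs) p with ∨-true⁻ {eqF v x} p
... | inj₁ v≡x   = here (eqF-true⁻ v≡x)
... | inj₂ v∈xs = there (memberᵇ-true⁻ xs v∈xs)

memberᵇ-false⁺ : ∀ {v : Fin n} {xs} → ¬ v ∈ xs → memberᵇ v xs ≡ false
memberᵇ-false⁺ {xs = []} _ = refl
memberᵇ-false⁺ {v = v} {x ∷ xs} v∉ with v FinP.≟ x
... | yes v≡x = ⊥-elim (v∉ (here v≡x))
... | no  _   = memberᵇ-false⁺ (v∉ ∘ there)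

count-memberᵇ : ∀ (xs : List (Fin n)) → Distinct xs → count (λ v → memberᵇ v xs) ≡ length xs
count-memberᵇ {n} [] _ = count-none {n} (λ v → memberᵇ v []) (λ _ → refl)
count-memberᵇ (x ∷ xs) (x∉xs , distinct) =
  trans (count-∨-disjoint (λ v → eqF v x) (λ v → memberᵇ v xs) disjoint)
        (cong₂ _+_ (count-eqF x) (count-memberᵇ xs distinct))
  where
  disjoint : ∀ v → eqF v x ∧ memberᵇ v xs ≡ false
  disjoint v with v FinP.≟ x
  ... | yes refl = memberᵇ-false⁺ x∉xs
  ... | no  _    = refl

distinct-length≤n : ∀ (xs : List (Fin n)) → Distinct xs → length xs ≤ n
distinct-length≤n xs distinct = subst (_≤ _) (count-memberᵇ xs distinct) (count≤n _)

SimpleWalk : ESet n → Fin n → Fin n → Set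
SimpleWalk E x y = Σ (Walk E x y) λ w → Distinct (vertices w)

drop-to : ∀ {E : ESet n} {x y z} (w : Walk E y z) → x ∈ vertices w → Distinct (vertices w) → SimpleWalk E x z
drop-to here       (here refl) distinct       = here , distinct
drop-to (step e w) (here refl) distinct       = step e w , distinct
drop-to (step e w) (there x∈w) (_ , distinct) = drop-to w x∈w distinct

loop-erase : ∀ {E : ESet n} {x y} → Walk E x y → SimpleWalk E x y
loop-erase here = here , (λ ()) , tt
loop-erase {x = x} (step e w) with loop-erase w
... | w′ , distinct with any? (x FinP.≟_) (vertices w′)
...   | yes x∈w′ = drop-to w′ x∈w′ distinct
...   | no  x∉w′ = step e w′ , x∉w′ , distinct

simple-walk-length<n : ∀ {E : ESet n} {x y} (s : SimpleWalk E x y) → walk-length (proj₁ s) < n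
simple-walk-length<n (w , distinct) = subst (_≤ _) (length-vertices w) (distinct-length≤n (vertices w) distinct)

anyᵇ : (Fin n → Bool) → Bool
anyᵇ {zero}  f = false
anyᵇ {suc n} f = f zero ∨ anyᵇ (f ∘ suc)

anyᵇ-true⁻ : ∀ (f : Fin n → Bool) → anyᵇ f ≡ true → ∃ λ i → f i ≡ true
anyᵇ-true⁻ {suc n} f p with f zero in f0
... | true  = zero , f0
... | false with anyᵇ-true⁻ (f ∘ suc) p
... | i , fi = suc i , fi

anyᵇ-true⁺ : ∀ (f : Fin n → Bool) i → f i ≡ true → anyᵇ f ≡ true
anyᵇ-true⁺ {suc n} f zero    fi rewrite fi = refl
anyᵇ-true⁺ {suc n} f (suc i) fi = ∨-trueʳ (f zero) (anyᵇ-true⁺ (f ∘ suc) i fi)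

allᵇ : (Fin n → Bool) → Bool
allᵇ f = not (anyᵇ (not ∘ f))

allᵇ-true⁻ : ∀ (f : Fin n → Bool) → allᵇ f ≡ true → ∀ i → f i ≡ true
allᵇ-true⁻ f p i with f i in fi
... | true  = refl
... | false = ⊥-elim (true≢false (anyᵇ-true⁺ (not ∘ f) i (cong not fi)) (not-true⁻ p))

allᵇ-true⁺ : ∀ (f : Fin n → Bool) → (∀ i → f i ≡ true) → allᵇ f ≡ true
allᵇ-true⁺ f all with anyᵇ (not ∘ f) in some
... | false = refl
... | true with anyᵇ-true⁻ (not ∘ f) some
... | i , ¬fi = ⊥-elim (true≢false (all i) (not-true⁻ ¬fi))

allᵇ-false⁻ : ∀ (f : Fin n → Bool) → allᵇ f ≡ false → ∃ λ i → f i ≡ false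
allᵇ-false⁻ f p with anyᵇ (not ∘ f) in some
allᵇ-false⁻ f () | false
... | true with anyᵇ-true⁻ (not ∘ f) some
... | i , ¬fi = i , not-true⁻ ¬fi

reachWithin : ℕ → ESet n → Fin n → Fin n → Bool
reachWithin zero    E u v = eqF u v
reachWithin (suc k) E u v = eqF u v ∨ anyᵇ (λ w → E u w ∧ reachWithin k E w v)

-- Simple walks are shorter than n, so n steps suffice.
reach : ESet n → Fin n → Fin n → Bool
reach {n} E u v = reachWithin n E u v

reachWithin-sound : ∀ k (E : ESet n) u v → reachWithin k E u v ≡ true → Walk E u v
reachWithin-sound zero E u v p rewrite eqF-true⁻ p = here
reachWithin-sound (suc k) E u v p with ∨-true⁻ {eqF u v} p
... | inj₁ u≡v rewrite eqF-true⁻ u≡v = here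
... | inj₂ further with anyᵇ-true⁻ _ further
... | w , uw = step (∧-trueˡ uw) (reachWithin-sound k E w v (∧-trueʳ uw))

reachWithin-complete : ∀ k (E : ESet n) {u v} (w : Walk E u v) → walk-length w ≤ k → reachWithin k E u v ≡ true
reachWithin-complete zero    E here _ = eqF-refl _
reachWithin-complete (suc k) E {u} here _ = ∨-trueˡ _ (eqF-refl u)
reachWithin-complete (suc k) E {u} {v} (step {w = x} e w) (s≤s short) =
  ∨-trueʳ (eqF u v) (anyᵇ-true⁺ _ x (∧-true⁺ e (reachWithin-complete k E w short)))

reach-sound : ∀ (E : ESet n) {u v} → reach E u v ≡ true → Walk E u v
reach-sound {n} E = reachWithin-sound n E _ _

reach-complete : ∀ (E : ESet n) {u v} → Walk E u v → reach E u v ≡ true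
reach-complete {n} E w =
  reachWithin-complete n E (proj₁ (loop-erase w)) (<⇒≤ (simple-walk-length<n (loop-erase w)))

reach-false⁻ : ∀ (E : ESet n) {u v} → reach E u v ≡ false → ¬ Walk E u v
reach-false⁻ E unreachable w = true≢false (reach-complete E w) unreachable

interior-neighbours : ∀ {E : ESet n} → Undirected E → ∀ {x y} (w : Walk E x y) → Distinct (vertices w) →
  ∀ s → s ∈ vertices w → ¬ s ≡ x → ¬ s ≡ y →
  ∃ λ p → ∃ λ q → ¬ p ≡ q × E s p ≡ true × E s q ≡ true × p ∈ vertices w × q ∈ vertices w
interior-neighbours _ here _ s (here refl) s≢x _ = ⊥-elim (s≢x refl)
interior-neighbours _ (step e w) _ s (here refl) s≢x _ = ⊥-elim (s≢x refl)
interior-neighbours _ (step e here) _ s (there (here refl)) _ s≢y = ⊥-elim (s≢y refl)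
interior-neighbours undirected (step {x} {w₁} e (step {w₁} {w₂} e′ w)) (x∉ , distinct) s (there s∈) s≢x s≢y
  with s FinP.≟ w₁
... | yes refl = x , w₂ , (λ x≡w₂ → x∉ (subst (_∈ _) (sym x≡w₂) (there (first∈vertices w)))) ,
                 trans (undirected w₁ x) e , e′ , here refl , there (there (first∈vertices w))
... | no s≢w₁ with interior-neighbours undirected (step e′ w) distinct s s∈ s≢w₁ s≢y
... | p , q , p≢q , sp , sq , p∈ , q∈ = p , q , p≢q , sp , sq , there p∈ , there q∈

last-neighbour : ∀ {E : ESet n} → Undirected E → ∀ {x w₁ y} (e : E x w₁ ≡ true) (w : Walk E w₁ y) →
  ∃ λ p → E y p ≡ true × p ∈ vertices (step e w)
last-neighbour undirected {x} {w₁} e here = x , trans (undirected w₁ x) e , here refl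
last-neighbour undirected e (step e′ w) with last-neighbour undirected e′ w
... | p , yp , p∈ = p , yp , there p∈

neighbour-of-degree≤2 : ∀ (E : ESet n) {s p q t} → deg E s ≤ 2 →
  E s p ≡ true → E s q ≡ true → ¬ p ≡ q → E s t ≡ true → t ≡ p ⊎ t ≡ q
neighbour-of-degree≤2 E {s} {p} {q} {t} deg≤2 sp sq p≢q st with t FinP.≟ p | t FinP.≟ q
... | yes t≡p | _       = inj₁ t≡p
... | no _    | yes t≡q = inj₂ t≡q
... | no t≢p  | no t≢q  = ⊥-elim (<⇒≱ (s≤s deg≤2) (count≥3 (E s) p q t sp sq st p≢q (t≢p ∘ sym) (t≢q ∘ sym)))

neighbour-of-degree≤1 : ∀ (E : ESet n) {s p t} → deg E s ≤ 1 → E s p ≡ true → E s t ≡ true → t ≡ p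
neighbour-of-degree≤1 E {s} {p} {t} deg≤1 sp st with t FinP.≟ p
... | yes t≡p = t≡p
... | no  t≢p = ⊥-elim (<⇒≱ (s≤s deg≤1) (count≥2 (E s) p t sp st (t≢p ∘ sym)))

-- The vertex set S of a loop-erased walk from x to y is closed: its inner vertices already have
-- two neighbours on it, and x and y have only one.
no-three-ends : ∀ (E : ESet n) → Undirected E → MaxDegree 2 E → ∀ {x y z} → ¬ x ≡ y → ¬ x ≡ z → ¬ y ≡ z →
  deg E x ≡ 1 → deg E y ≡ 1 → deg E z ≡ 1 → Walk E x y → Walk E x z → ⊥
no-three-ends E undirected deg≤2 {x} {y} {z} x≢y x≢z y≢z dx dy dz xy xz with loop-erase xy
... | here , _ = x≢y refl
... | step e w , distinct = z∉S (walk-stays {W = S} closed (memberᵇ-true⁺ {xs = vertices (step e w)} (here refl)) xz)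
  where
  S : VSet _
  S v = memberᵇ v (vertices (step e w))
  closed : Closed E S
  closed a b Sa ab = by-position (a FinP.≟ x) (a FinP.≟ y)
    where
    by-position : Dec (a ≡ x) → Dec (a ≡ y) → S b ≡ true
    by-position (yes refl) _ =
      memberᵇ-true⁺ (subst (_∈ vertices (step e w)) (sym (neighbour-of-degree≤1 E (≤-reflexive dx) e ab)) (there (first∈vertices w)))
    by-position (no _) (yes refl) with last-neighbour undirected e w
    ... | p , yp , p∈ = memberᵇ-true⁺ (subst (_∈ vertices (step e w)) (sym (neighbour-of-degree≤1 E (≤-reflexive dy) yp ab)) p∈)
    by-position (no a≢x) (no a≢y) with interior-neighbours undirected (step e w) distinct a (memberᵇ-true⁻ _ Sa) a≢x a≢y
    ... | p , q , p≢q , ap , aq , p∈ , q∈ with neighbour-of-degree≤2 E (deg≤2 a) ap aq p≢q ab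
    ...   | inj₁ refl = memberᵇ-true⁺ p∈
    ...   | inj₂ refl = memberᵇ-true⁺ q∈
  z∉S : S z ≢ true
  z∉S Sz with interior-neighbours undirected (step e w) distinct z (memberᵇ-true⁻ _ Sz) (x≢z ∘ sym) (y≢z ∘ sym)
  ... | p , q , p≢q , zp , zq , _ = <⇒≱ (≤-reflexive (cong suc dz)) (count≥2 (E z) p q zp zq p≢q)

-- As in no-three-ends, the vertices of a loop-erased walk from c to d avoiding the edge cd
-- form a closed set of vertices of degree two whose edges all lie in E.
cycle-edge⇒cycle-component : ∀ (H E : ESet n) → Undirected H → Loopless H → MaxDegree 2 H → Undirected E → E ⊆ᴱ H →
  ∀ {c d} → E c d ≡ true → Walk (deleteEdge E c d) c d →
  ∀ v → Walk H c v → deg H v ≡ 2 × (∀ t → H v t ≡ true → E v t ≡ true)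
cycle-edge⇒cycle-component H E _ loopless deg≤2 undirected E⊆H {c} {d} cd around v cv with loop-erase around
... | here , _ = ⊥-elim (true≢false (E⊆H c c cd) (loopless c))
... | step {c} e w , distinct = ≤-antisym (deg≤2 v) (proj₁ (on-cycle v Sv)) , (λ t vt → proj₂ (proj₂ (on-cycle v Sv) t vt))
  where
  E′ = deleteEdge E c d
  W = step e w
  S : VSet _
  S x = memberᵇ x (vertices W)
  two-on-W : ∀ a {p q} → ¬ p ≡ q → E a p ≡ true → E a q ≡ true → p ∈ vertices W → q ∈ vertices W →
    2 ≤ deg H a × (∀ t → H a t ≡ true → S t ≡ true × E a t ≡ true)
  two-on-W a {p} {q} p≢q ap aq p∈ q∈ =
    count≥2 (H a) p q (E⊆H _ _ ap) (E⊆H _ _ aq) p≢q ,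
    λ t at → one-of t (neighbour-of-degree≤2 H (deg≤2 a) (E⊆H _ _ ap) (E⊆H _ _ aq) p≢q at)
    where
    one-of : ∀ t → t ≡ p ⊎ t ≡ q → S t ≡ true × E a t ≡ true
    one-of t (inj₁ refl) = memberᵇ-true⁺ p∈ , ap
    one-of t (inj₂ refl) = memberᵇ-true⁺ q∈ , aq
  on-cycle : ∀ a → S a ≡ true → 2 ≤ deg H a × (∀ t → H a t ≡ true → S t ≡ true × E a t ≡ true)
  on-cycle a Sa = by-position (a FinP.≟ c) (a FinP.≟ d)
    where
    by-position : Dec (a ≡ c) → Dec (a ≡ d) → 2 ≤ deg H a × (∀ t → H a t ≡ true → S t ≡ true × E a t ≡ true)
    by-position (yes refl) _ =
      two-on-W a (λ w₁≡d → true≢false (subst (λ x → E′ c x ≡ true) w₁≡d e) (deleteEdge-removes E c d))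
        (∧-trueˡ e) cd (there (first∈vertices w)) (last∈vertices W)
    by-position (no _) (yes refl) with last-neighbour (deleteEdge-undirected E c d undirected) e w
    ... | p , dp , p∈ = two-on-W a (λ p≡c → true≢false (subst (λ x → E′ d x ≡ true) p≡c dp) (deleteEdge-removes′ E c d))
                          (∧-trueˡ dp) (trans (undirected d c) cd) p∈ (first∈vertices W)
    by-position (no a≢c) (no a≢d)
      with interior-neighbours (deleteEdge-undirected E c d undirected) W distinct a (memberᵇ-true⁻ _ Sa) a≢c a≢d
    ... | p , q , p≢q , ap , aq , p∈ , q∈ = two-on-W a p≢q (∧-trueˡ ap) (∧-trueˡ aq) p∈ q∈
  closed : Closed H S
  closed a b Sa ab = proj₁ (proj₂ (on-cycle a Sa) b ab)
  Sv : S v ≡ true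
  Sv = walk-stays {W = S} closed (memberᵇ-true⁺ {xs = vertices W} (here refl)) cv

concatF : ∀ {A : Set} → (Fin n → List A) → List A
concatF {zero}  f = []
concatF {suc n} f = f zero ++ concatF (f ∘ suc)

concatF-∈⁺ : ∀ {A : Set} (f : Fin n → List A) i {x} → x ∈ f i → x ∈ concatF f
concatF-∈⁺ {suc n} f zero    x∈ = ∈-++⁺ˡ x∈
concatF-∈⁺ {suc n} f (suc i) x∈ = ∈-++⁺ʳ (f zero) (concatF-∈⁺ (f ∘ suc) i x∈)

concatF-∈⁻ : ∀ {A : Set} (f : Fin n → List A) {x} → x ∈ concatF f → ∃ λ i → x ∈ f i
concatF-∈⁻ {suc n} f x∈ with ∈-++⁻ (f zero) x∈
... | inj₁ x∈f0 = zero , x∈f0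
... | inj₂ x∈fs with concatF-∈⁻ (f ∘ suc) x∈fs
... | i , x∈fi = suc i , x∈fi

singletonIf : ∀ {A : Set} → Bool → A → List A
singletonIf true  x = x ∷ []
singletonIf false x = []

singletonIf-∈⁻ : ∀ {A : Set} b (x : A) {y} → y ∈ singletonIf b x → b ≡ true × y ≡ x
singletonIf-∈⁻ true x (here refl) = refl , refl

edgeList : ESet n → List (Fin n × Fin n)
edgeList E = concatF (λ i → concatF (λ j → singletonIf (E i j ∧ ltF i j) (i , j)))

edgeList-∈⁺ : ∀ (E : ESet n) {i j} → E i j ∧ ltF i j ≡ true → (i , j) ∈ edgeList E
edgeList-∈⁺ E {i} {j} p = concatF-∈⁺ _ i (concatF-∈⁺ _ j (listed p))
  where
  listed : ∀ {b} → b ≡ true → (i , j) ∈ singletonIf b (i , j)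
  listed refl = here refl

edgeList-∈⁻-ordered : ∀ (E : ESet n) {a b} → (a , b) ∈ edgeList E → E a b ∧ ltF a b ≡ true
edgeList-∈⁻-ordered E m with concatF-∈⁻ _ m
... | i , m′ with concatF-∈⁻ _ m′
... | j , m″ with singletonIf-∈⁻ (E i j ∧ ltF i j) (i , j) m″
... | ordered , refl = ordered

edgeList-∈⁻ : ∀ (E : ESet n) {a b} → (a , b) ∈ edgeList E → E a b ≡ true
edgeList-∈⁻ E m = ∧-trueˡ (edgeList-∈⁻-ordered E m)

Listed : List (Fin n × Fin n) → Fin n → Fin n → Set
Listed l a b = (a , b) ∈ l ⊎ (b , a) ∈ l

edgeList-covers : ∀ (E : ESet n) → Undirected E → ∀ {a b} → E a b ≡ true → ¬ a ≡ b → Listed (edgeList E) a b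
edgeList-covers E undirected {a} {b} e a≢b with ∨-true⁻ (ltF-connex a≢b)
... | inj₁ a<b = inj₁ (edgeList-∈⁺ E (∧-true⁺ e a<b))
... | inj₂ b<a = inj₂ (edgeList-∈⁺ E (∧-true⁺ (trans (undirected b a) e) b<a))

edgeList-Listed⁻ : ∀ {E : ESet n} → Undirected E → ∀ {a b} → Listed (edgeList E) a b → E a b ≡ true
edgeList-Listed⁻ {E = E} undirected (inj₁ m) = edgeList-∈⁻ E m
edgeList-Listed⁻ {E = E} undirected (inj₂ m) = trans (undirected _ _) (edgeList-∈⁻ E m)

Listed-++ˡ : ∀ {l} (l′ : List (Fin n × Fin n)) {u v} → Listed l u v → Listed (l ++ l′) u v
Listed-++ˡ l′ (inj₁ m) = inj₁ (∈-++⁺ˡ m)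
Listed-++ˡ l′ (inj₂ m) = inj₂ (∈-++⁺ˡ m)

Listed-++ʳ : ∀ (l : List (Fin n × Fin n)) {l′ u v} → Listed l′ u v → Listed (l ++ l′) u v
Listed-++ʳ l (inj₁ m) = inj₁ (∈-++⁺ʳ l m)
Listed-++ʳ l (inj₂ m) = inj₂ (∈-++⁺ʳ l m)

Listed-++⁻ : ∀ (l : List (Fin n × Fin n)) {l′ u v} → Listed (l ++ l′) u v → Listed l u v ⊎ Listed l′ u v
Listed-++⁻ l (inj₁ m) with ∈-++⁻ l m
... | inj₁ m′ = inj₁ (inj₁ m′)
... | inj₂ m′ = inj₂ (inj₁ m′)
Listed-++⁻ l (inj₂ m) with ∈-++⁻ l m
... | inj₁ m′ = inj₁ (inj₂ m′)
... | inj₂ m′ = inj₂ (inj₂ m′)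

Listed-walk : ∀ (E : ESet n) → Undirected E → ∀ l {a b} → (∀ u v → (u , v) ∈ l → Walk E u v) → Listed l a b → Walk E a b
Listed-walk E undirected l walk (inj₁ m) = walk _ _ m
Listed-walk E undirected l walk (inj₂ m) = walk-reverse undirected (walk _ _ m)

least : ∀ {k} (P : Fin k → Bool) i → P i ≡ true → ∃ λ m → P m ≡ true × (∀ j → ltF j m ≡ true → P j ≡ false)
least {suc k} P i Pi with P zero in P0
... | true = zero , P0 , λ j j<0 → ⊥-elim (nothing-below-zero j (ltF-true⁻ j<0))
  where
  nothing-below-zero : ∀ j → ¬ j <F zero {k}
  nothing-below-zero j ()
... | false with i
...   | zero  = ⊥-elim (true≢false Pi P0)
...   | suc i′ with least (P ∘ suc) i′ Pi
...     | m , Pm , below = suc m , Pm , earlier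
  where
  earlier : ∀ j → ltF j (suc m) ≡ true → P j ≡ false
  earlier zero    _   = P0
  earlier (suc j) j<m = below j (ltF-true⁺ (≤-pred (ltF-true⁻ j<m)))

isPair : Fin n → Fin n → Fin n → Fin n → Bool
isPair u v a b = (eqF a u ∧ eqF b v) ∨ (eqF a v ∧ eqF b u)

isPair-true⁻ : ∀ (u v a b : Fin n) → isPair u v a b ≡ true → (a ≡ u × b ≡ v) ⊎ (a ≡ v × b ≡ u)
isPair-true⁻ u v a b p with ∨-true⁻ {eqF a u ∧ eqF b v} p
... | inj₁ q = inj₁ (eqF-true⁻ (∧-trueˡ q) , eqF-true⁻ (∧-trueʳ q))
... | inj₂ q = inj₂ (eqF-true⁻ (∧-trueˡ q) , eqF-true⁻ (∧-trueʳ q))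

isPair-refl : ∀ (u v : Fin n) → isPair u v u v ≡ true
isPair-refl u v rewrite eqF-refl u | eqF-refl v = refl

isPair-cong : ∀ {u v a b : Fin n} → isPair u v a b ≡ true → ∀ x y → isPair a b x y ≡ isPair u v x y
isPair-cong {u = u} {v} {a} {b} p x y with isPair-true⁻ u v a b p
... | inj₁ (refl , refl) = refl
... | inj₂ (refl , refl) = BP.∨-comm (eqF x v ∧ eqF y u) (eqF x u ∧ eqF y v)

addEdge : ESet n → Fin n → Fin n → ESet n
addEdge E u v a b = E a b ∨ isPair u v a b

addEdge-undirected : ∀ (E : ESet n) u v → Undirected E → Undirected (addEdge E u v)
addEdge-undirected E u v undirected a b
  rewrite undirected a b | BP.∧-comm (eqF a u) (eqF b v) | BP.∧-comm (eqF a v) (eqF b u)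
        | BP.∨-comm (eqF b v ∧ eqF a u) (eqF b u ∧ eqF a v) = refl

walk-addEdge : ∀ (E : ESet n) u v {x y} → Walk (addEdge E u v) x y →
  Walk E x y ⊎ ((Walk E x u × Walk E v y) ⊎ (Walk E x v × Walk E u y))
walk-addEdge E u v here = inj₁ here
walk-addEdge E u v {x} (step {w = w} e rest) with walk-addEdge E u v rest | ∨-true⁻ {E x w} e
... | inj₁ w⇝y                | inj₁ old = inj₁ (step old w⇝y)
... | inj₂ (inj₁ (w⇝u , v⇝y)) | inj₁ old = inj₂ (inj₁ (step old w⇝u , v⇝y))
... | inj₂ (inj₂ (w⇝v , u⇝y)) | inj₁ old = inj₂ (inj₂ (step old w⇝v , u⇝y))
... | r | inj₂ new with isPair-true⁻ u v x w new | r
...   | inj₁ (refl , refl) | inj₁ v⇝y                = inj₂ (inj₁ (here , v⇝y))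
...   | inj₁ (refl , refl) | inj₂ (inj₁ (_ , v⇝y))   = inj₂ (inj₁ (here , v⇝y))
...   | inj₁ (refl , refl) | inj₂ (inj₂ (_ , u⇝y))   = inj₁ u⇝y
...   | inj₂ (refl , refl) | inj₁ u⇝y                = inj₂ (inj₂ (here , u⇝y))
...   | inj₂ (refl , refl) | inj₂ (inj₁ (_ , v⇝y))   = inj₁ v⇝y
...   | inj₂ (refl , refl) | inj₂ (inj₂ (_ , u⇝y))   = inj₂ (inj₂ (here , u⇝y))

greedyStep : ESet n → Fin n × Fin n → ESet n
greedyStep E (u , v) = if reach E u v then E else addEdge E u v

greedy : ESet n → List (Fin n × Fin n) → ESet n
greedy E []       = E
greedy E (p ∷ ps) = greedy (greedyStep E p) ps

∅ᴱ : ESet n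
∅ᴱ _ _ = false

greedy-++ : ∀ (E : ESet n) xs ys → greedy E (xs ++ ys) ≡ greedy (greedy E xs) ys
greedy-++ E []       ys = refl
greedy-++ E (x ∷ xs) ys = greedy-++ (greedyStep E x) xs ys

greedyStep-⊇ : ∀ (E : ESet n) p → E ⊆ᴱ greedyStep E p
greedyStep-⊇ E (u , v) a b e with reach E u v
... | true  = e
... | false = ∨-trueˡ _ e

greedy-⊇ : ∀ (E : ESet n) l → E ⊆ᴱ greedy E l
greedy-⊇ E []      a b e = e
greedy-⊇ E (p ∷ l) a b e = greedy-⊇ (greedyStep E p) l a b (greedyStep-⊇ E p a b e)

greedyStep-undirected : ∀ (E : ESet n) p → Undirected E → Undirected (greedyStep E p)
greedyStep-undirected E (u , v) undirected with reach E u v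
... | true  = undirected
... | false = addEdge-undirected E u v undirected

greedy-undirected : ∀ (E : ESet n) l → Undirected E → Undirected (greedy E l)
greedy-undirected E []      undirected = undirected
greedy-undirected E (p ∷ l) undirected = greedy-undirected (greedyStep E p) l (greedyStep-undirected E p undirected)

greedyStep-origin : ∀ (E : ESet n) u v a b → greedyStep E (u , v) a b ≡ true →
  E a b ≡ true ⊎ ((a ≡ u × b ≡ v) ⊎ (a ≡ v × b ≡ u))
greedyStep-origin E u v a b p with reach E u v
... | true = inj₁ p
... | false with ∨-true⁻ {E a b} p
...   | inj₁ old = inj₁ old
...   | inj₂ new = inj₂ (isPair-true⁻ u v a b new)

greedy-origin : ∀ (E : ESet n) l a b → greedy E l a b ≡ true → E a b ≡ true ⊎ Listed l a b
greedy-origin E [] a b p = inj₁ p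
greedy-origin E ((u , v) ∷ l) a b p with greedy-origin (greedyStep E (u , v)) l a b p
... | inj₂ (inj₁ m) = inj₂ (inj₁ (there m))
... | inj₂ (inj₂ m) = inj₂ (inj₂ (there m))
... | inj₁ q with greedyStep-origin E u v a b q
...   | inj₁ old                 = inj₁ old
...   | inj₂ (inj₁ (refl , refl)) = inj₂ (inj₁ (here refl))
...   | inj₂ (inj₂ (refl , refl)) = inj₂ (inj₂ (here refl))

greedyStep-accepts : ∀ (E : ESet n) u v → reach E u v ≡ false → greedyStep E (u , v) u v ≡ true
greedyStep-accepts E u v unreachable rewrite unreachable = ∨-trueʳ (E u v) (isPair-refl u v)

greedyStep-accepts-or-connected : ∀ (E : ESet n) u v → greedyStep E (u , v) u v ≡ true ⊎ Walk E u v
greedyStep-accepts-or-connected E u v with reach E u v in r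
... | true  = inj₂ (reach-sound E r)
... | false = inj₁ (∨-trueʳ (E u v) (isPair-refl u v))

greedyStep-connects : ∀ (E : ESet n) u v → Walk (greedyStep E (u , v)) u v
greedyStep-connects E u v with greedyStep-accepts-or-connected E u v
... | inj₁ accepted  = step accepted here
... | inj₂ connected = walk-map (greedyStep-⊇ E (u , v)) connected

greedy-connects : ∀ (E : ESet n) l u v → (u , v) ∈ l → Walk (greedy E l) u v
greedy-connects E (p ∷ l) u v (here refl) = walk-map (greedy-⊇ (greedyStep E p) l) (greedyStep-connects E u v)
greedy-connects E (p ∷ l) u v (there m)   = greedy-connects (greedyStep E p) l u v m

EdgesAreBridges : ESet n → Set
EdgesAreBridges E = ∀ a b → E a b ≡ true → Walk (deleteEdge E a b) a b → ⊥

-- A walk around the new edge uv would connect u and v without it; one around an old edge ab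
-- would, after removing uv, either avoid it or yield a walk from u to v.
bridges-addEdge : ∀ (E : ESet n) u v → Undirected E → EdgesAreBridges E → ¬ Walk E u v →
  EdgesAreBridges (addEdge E u v)
bridges-addEdge E u v undirected bridges u≁v a b ab around with isPair u v a b in is-uv
... | true = u≁v (as-uv (isPair-true⁻ u v a b is-uv) (walk-map old around))
  where
  old : deleteEdge (addEdge E u v) a b ⊆ᴱ E
  old x y p with ∨-true⁻ {E x y} (∧-trueˡ p)
  ... | inj₁ xy = xy
  ... | inj₂ new = ⊥-elim (true≢false (trans (isPair-cong {u = u} {v} {a} {b} is-uv x y) new) (not-true⁻ (∧-trueʳ p)))
  as-uv : (a ≡ u × b ≡ v) ⊎ (a ≡ v × b ≡ u) → Walk E a b → Walk E u v
  as-uv (inj₁ (refl , refl)) w = w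
  as-uv (inj₂ (refl , refl)) w = walk-reverse undirected w
... | false = cases (walk-addEdge (deleteEdge E a b) u v (walk-map moved around))
  where
  E-ab : E a b ≡ true
  E-ab with ∨-true⁻ {E a b} ab
  ... | inj₁ old = old
  moved : deleteEdge (addEdge E u v) a b ⊆ᴱ addEdge (deleteEdge E a b) u v
  moved x y p with ∨-true⁻ {E x y} (∧-trueˡ p)
  ... | inj₁ old = ∨-trueˡ _ (∧-true⁺ old (∧-trueʳ p))
  ... | inj₂ new = ∨-trueʳ (deleteEdge E a b x y) new
  within : ∀ {x y} → Walk (deleteEdge E a b) x y → Walk E x y
  within = walk-map (deleteEdge-⊆ E a b)
  cases : _ → ⊥
  cases (inj₁ w)                = bridges a b E-ab w
  cases (inj₂ (inj₁ (a⇝u , v⇝b))) = u≁v (walk-reverse undirected (within a⇝u) ++ʷ step E-ab (walk-reverse undirected (within v⇝b)))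
  cases (inj₂ (inj₂ (a⇝v , u⇝b))) = u≁v (within u⇝b ++ʷ step (trans (undirected b a) E-ab) (within a⇝v))

bridges-greedy : ∀ (E : ESet n) l → Undirected E → EdgesAreBridges E → EdgesAreBridges (greedy E l)
bridges-greedy E [] undirected bridges = bridges
bridges-greedy E ((u , v) ∷ l) undirected bridges =
  bridges-greedy (greedyStep E (u , v)) l (greedyStep-undirected E (u , v) undirected) step-bridges
  where
  step-bridges : EdgesAreBridges (greedyStep E (u , v))
  step-bridges with reach E u v in r
  ... | true  = bridges
  ... | false = bridges-addEdge E u v undirected bridges (reach-false⁻ E r)

bridges⇒acyclic : ∀ (E : ESet n) → Undirected E → EdgesAreBridges E → Acyclic E
bridges⇒acyclic E undirected bridges (m , f , injective , edges , closing) =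
  bridges (f zero) (f last) (trans (undirected (f zero) (f last)) closing)
          (walk-along E′ (suc (suc m)) f (λ i → ∧-true⁺ (edges i) (not-true⁺ (not-closing i))))
  where
  last = fromℕ (suc (suc m))
  E′ = deleteEdge E (f zero) (f last)
  not-closing : ∀ i → isPair (f zero) (f last) (f (inject₁ i)) (f (suc i)) ≡ false
  not-closing i with isPair (f zero) (f last) (f (inject₁ i)) (f (suc i)) in closes
  ... | false = refl
  ... | true with isPair-true⁻ (f zero) (f last) (f (inject₁ i)) (f (suc i)) closes
  ...   | inj₁ (i≡0 , i+1≡last) = ⊥-elim (first≢last i (injective _ _ i≡0) (FinP.suc-injective (injective _ _ i+1≡last)))
    where
    first≢last : ∀ (i : Fin (suc (suc m))) → inject₁ i ≡ zero → i ≡ fromℕ (suc m) → ⊥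
    first≢last i i≡0 refl with i≡0
    ... | ()
  ...   | inj₂ (_ , i+1≡0) with injective _ _ i+1≡0
  ...     | ()

-- A new edge accepted by the first run joins vertices the first forest does not connect, hence
-- neither does the second forest, whose connectivity is no larger.
greedy-compare : ∀ l (E₁ E₂ : ESet n) → Undirected E₁ → (∀ a b → E₂ a b ≡ true → Walk E₁ a b) →
  ∀ a b → greedy E₁ l a b ≡ true → E₁ a b ≡ true ⊎ greedy E₂ l a b ≡ true
greedy-compare [] E₁ E₂ _ _ a b p = inj₁ p
greedy-compare ((u , v) ∷ l) E₁ E₂ undirected E₂⇝E₁ a b p
  with greedy-compare l (greedyStep E₁ (u , v)) (greedyStep E₂ (u , v)) (greedyStep-undirected E₁ (u , v) undirected) step⇝ a b p
  where
  step⇝ : ∀ a b → greedyStep E₂ (u , v) a b ≡ true → Walk (greedyStep E₁ (u , v)) a b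
  step⇝ a b q with greedyStep-origin E₂ u v a b q
  ... | inj₁ old                 = walk-map (greedyStep-⊇ E₁ (u , v)) (E₂⇝E₁ a b old)
  ... | inj₂ (inj₁ (refl , refl)) = greedyStep-connects E₁ u v
  ... | inj₂ (inj₂ (refl , refl)) = walk-reverse (greedyStep-undirected E₁ (u , v) undirected) (greedyStep-connects E₁ u v)
... | inj₂ later = inj₂ later
... | inj₁ now with reach E₁ u v in r₁
...   | true  = inj₁ now
...   | false with ∨-true⁻ {E₁ a b} now
...     | inj₁ old = inj₁ old
...     | inj₂ new with reach E₂ u v in r₂
...       | true  = ⊥-elim (true≢false (reach-complete E₁ (walk-refine E₂⇝E₁ (reach-sound E₂ r₂))) r₁)
...       | false = inj₂ (greedy-⊇ (addEdge E₂ u v) l a b (∨-trueʳ (E₂ a b) new))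

-- Until an edge crossing C is offered, the forest respects C, so that edge cannot close a cycle.
greedy-crosses : ∀ l (E : ESet n) (C : VSet n) → Respects E C →
  (∃ λ u → ∃ λ v → (u , v) ∈ l × ¬ C u ≡ C v) →
  ∃ λ u → ∃ λ v → (u , v) ∈ l × ¬ C u ≡ C v × greedy E l u v ≡ true
greedy-crosses ((u , v) ∷ l) E C respects crossing with C u BP.≟ C v
... | no cross = u , v , here refl , cross , greedy-⊇ _ l u v (greedyStep-accepts E u v unreachable)
  where
  unreachable : reach E u v ≡ false
  unreachable = ¬true⇒false (cross ∘ walk-respects respects ∘ reach-sound E)
... | yes same with greedy-crosses l (greedyStep E (u , v)) C respects′ (later crossing)
  where
  respects′ : Respects (greedyStep E (u , v)) C
  respects′ a b e with greedyStep-origin E u v a b e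
  ... | inj₁ old                 = respects a b old
  ... | inj₂ (inj₁ (refl , refl)) = same
  ... | inj₂ (inj₂ (refl , refl)) = sym same
  later : (∃ λ x → ∃ λ y → (x , y) ∈ (u , v) ∷ l × ¬ C x ≡ C y) → ∃ λ x → ∃ λ y → (x , y) ∈ l × ¬ C x ≡ C y
  later (x , y , here refl , cross) = ⊥-elim (cross same)
  later (x , y , there m , cross)   = x , y , m , cross
... | x , y , m , cross , accepted = x , y , there m , cross , accepted

-- A path with a endpoints and b inner vertices has degree sum a + 2 * b; a cycle with c
-- vertices has degree sum 2 * c.

short-path-ratio : ∀ {a b I} → a ≤ 2 → suc b ≤ I → 3 * (a + 2 * b) ≤ 8 * I
short-path-ratio {a} {b} {I} a≤2 b<I = begin
  3 * (a + 2 * b)               ≤⟨ *-monoʳ-≤ 3 (+-monoˡ-≤ (2 * b) a≤2) ⟩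
  3 * (2 + 2 * b)               ≤⟨ m≤m+n _ _ ⟩
  3 * (2 + 2 * b) + (2 + 2 * b) ≡⟨ expand b ⟩
  8 * suc b                     ≤⟨ *-monoʳ-≤ 8 b<I ⟩
  8 * I                         ∎
  where
  open ≤-Reasoning
  expand : ∀ b → 3 * (2 + 2 * b) + (2 + 2 * b) ≡ 8 * suc b
  expand = solve-∀

long-path-ratio : ∀ {a b I} → a ≤ 2 → 8 ≤ a + 2 * b → b ≤ I → 3 * (a + 2 * b) ≤ 8 * I
long-path-ratio {a} {b} {I} a≤2 8≤deg b≤I = begin
  3 * (a + 2 * b) ≤⟨ *-monoʳ-≤ 3 (+-monoˡ-≤ (2 * b) a≤2) ⟩
  3 * (2 + 2 * b) ≡⟨ expand b ⟩
  6 + 6 * b       ≤⟨ +-monoˡ-≤ (6 * b) 6≤2b ⟩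
  2 * b + 6 * b   ≡⟨ collect b ⟩
  8 * b           ≤⟨ *-monoʳ-≤ 8 b≤I ⟩
  8 * I           ∎
  where
  open ≤-Reasoning
  expand : ∀ b → 3 * (2 + 2 * b) ≡ 6 + 6 * b
  expand = solve-∀
  collect : ∀ b → 2 * b + 6 * b ≡ 8 * b
  collect = solve-∀
  6≤2b : 6 ≤ 2 * b
  6≤2b = s≤s⁻¹ (s≤s⁻¹ (≤-trans 8≤deg (+-monoˡ-≤ (2 * b) a≤2)))

cycle-ratio : ∀ {c I} → 4 ≤ c → c ≤ suc I → 3 * (2 * c) ≤ 8 * I
cycle-ratio {c} {I} 4≤c c≤1+I = +-cancelʳ-≤ 8 _ _ (begin
  3 * (2 * c) + 8     ≤⟨ +-monoʳ-≤ (3 * (2 * c)) (*-monoʳ-≤ 2 4≤c) ⟩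
  3 * (2 * c) + 2 * c ≡⟨ collect c ⟩
  8 * c               ≤⟨ *-monoʳ-≤ 8 c≤1+I ⟩
  8 * suc I           ≡⟨ expand I ⟩
  8 * I + 8           ∎)
  where
  open ≤-Reasoning
  collect : ∀ c → 3 * (2 * c) + 2 * c ≡ 8 * c
  collect = solve-∀
  expand : ∀ i → 8 * suc i ≡ 8 * i + 8
  expand = solve-∀

module Construction {n : ℕ} (G : SimpleGraph n) (H : ESet n) (cover : PCC G H)
  (connected : Connected (adj G))
  (disconnected : ¬ NComp allV H 1)
  (cycles≥4 : ∀ C → IsComp H C → IsCycleComp H C → 4 ≤ compEdges H C)
  (shortPaths : ∀ C → IsComp H C → IsPathComp H C → 1 ≤ compEdges H C → compEdges H C ≤ 3 →
    ∃ λ v → C v ≡ true × Endpoint H v × (∃ λ w → adj G v w ≡ true × InnerOfPath H 4 w))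
  where

  H⊆G : H ⊆ᴱ adj G
  H⊆G = proj₁ (proj₁ cover)

  H-undirected : Undirected H
  H-undirected = proj₂ (proj₁ cover)

  H-maxDegree2 : MaxDegree 2 H
  H-maxDegree2 = proj₂ cover

  G-undirected : Undirected (adj G)
  G-undirected = SimpleGraph.sym G

  H-loopless : Loopless H
  H-loopless v = ¬true⇒false (λ p → true≢false (H⊆G v v p) (irrefl G v))

  opaque
    comp : Fin n → VSet n
    comp r = reach H r

    comp-walk : ∀ {r v} → comp r v ≡ true → Walk H r v
    comp-walk = reach-sound H

    comp-∋ : ∀ {r v} → Walk H r v → comp r v ≡ true
    comp-∋ = reach-complete H

  comp-refl : ∀ r → comp r r ≡ true
  comp-refl r = comp-∋ here

  comp-closed : ∀ r → Closed H (comp r)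
  comp-closed r a b ra h = comp-∋ (comp-walk ra ++ʷ step h here)

  comp-same : ∀ {r v} → comp r v ≡ true → ∀ x → comp v x ≡ comp r x
  comp-same rv x = bool-ext (λ vx → comp-∋ (comp-walk rv ++ʷ comp-walk vx))
                            (λ rx → comp-∋ (walk-reverse H-undirected (comp-walk rv) ++ʷ comp-walk rx))

  comp-sym : ∀ {r v} → comp r v ≡ true → comp v r ≡ true
  comp-sym rv = comp-∋ (walk-reverse H-undirected (comp-walk rv))

  comp-isComp : ∀ r → IsComp H (comp r)
  comp-isComp r = (r , comp-refl r) , λ u ru v →
    (λ rv → walk-reverse H-undirected (comp-walk ru) ++ʷ comp-walk rv) , (λ w → comp-∋ (comp-walk ru ++ʷ w))

  IsComp⇒comp : ∀ {C} → IsComp H C → ∀ {x} → C x ≡ true → ∀ y → C y ≡ comp x y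
  IsComp⇒comp (_ , isComp) {x} Cx y =
    bool-ext (λ Cy → comp-∋ (proj₁ (isComp x Cx y) Cy)) (λ xy → proj₂ (isComp x Cx y) (comp-walk xy))

  H-respects-comp : ∀ r → Respects H (comp r)
  H-respects-comp r a b h = bool-ext (λ ra → comp-closed r a b ra h)
                                     (λ rb → comp-closed r b a rb (trans (H-undirected b a) h))

  comp-proper : ∀ r → ∃ λ o → comp r o ≡ false
  comp-proper r with allᵇ (comp r) in everything
  ... | false = allᵇ-false⁻ _ everything
  ... | true  = ⊥-elim (disconnected ((λ _ → zero) , (λ u v _ _ → (λ _ → walk u v) , (λ _ → refl)) , onto))
    where
    walk : ∀ u v → Walk (restrictE allV H) u v
    walk u v = walk-map (λ _ _ h → h)
      (walk-reverse H-undirected (comp-walk (allᵇ-true⁻ _ everything u)) ++ʷ comp-walk (allᵇ-true⁻ _ everything v))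
    onto : ∀ c → ∃ λ u → allV u ≡ true × zero ≡ c
    onto zero = r , refl , refl

  size : Fin n → ℕ
  size r = compEdges H (comp r)

  compEdges-cong : ∀ {C C'} → (∀ x → C x ≡ C' x) → compEdges H C ≡ compEdges H C'
  compEdges-cong C≗C' = edgeCount-cong (λ a b → cong₂ (λ p q → p ∧ q ∧ H a b) (C≗C' a) (C≗C' b))

  size-same : ∀ {r v} → comp r v ≡ true → size v ≡ size r
  size-same rv = compEdges-cong (comp-same rv)

  deg-restrict : ∀ r v → deg (restrictE (comp r) H) v ≡ (if comp r v then deg H v else 0)
  deg-restrict r v with comp r v in rv
  ... | true = count-cong inside
    where
    inside : ∀ w → comp r w ∧ H v w ≡ H v w
    inside w with H v w in h
    ... | true  = trans (BP.∧-identityʳ _) (comp-closed r v w rv h)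
    ... | false = BP.∧-zeroʳ _
  ... | false = count-none (λ w → false ∧ (comp r w ∧ H v w)) (λ _ → refl)

  comp-handshake : ∀ r → sumIn (comp r) (deg H) ≡ 2 * size r
  comp-handshake r = trans (sumF-cong (λ v → sym (deg-restrict r v)))
    (handshake (restrictE (comp r) H) (restrictE-undirected (comp r) {H} H-undirected) (restrictE-loopless (comp r) {H} H-loopless))

  has-neighbour : ∀ r → 1 ≤ size r → ∀ v → comp r v ≡ true → ∃ λ t → H v t ≡ true
  has-neighbour r 1≤size v rv
    with sumF>0⇒∃ _ (subst (0 <_) (sym (comp-handshake r)) (≤-trans (s≤s z≤n) (*-monoʳ-≤ 2 1≤size)))
  ... | u , 0<deg with comp r u in ru
  ... | false = ⊥-elim (<⇒≱ 0<deg z≤n)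
  ... | true with count>0⇒∃ (H u) 0<deg | v FinP.≟ u
  ...   | t , ut | yes refl = t , ut
  ...   | _      | no v≢u   = walk-first-edge (walk-reverse H-undirected (comp-walk rv) ++ʷ comp-walk ru) v≢u

  deg1ᵇ deg2ᵇ : Fin n → Bool
  deg1ᵇ v = ⌊ deg H v N.≟ 1 ⌋
  deg2ᵇ v = ⌊ deg H v N.≟ 2 ⌋

  deg-decompose : ∀ v → deg H v ≡ ind (deg1ᵇ v) + 2 * ind (deg2ᵇ v)
  deg-decompose v = by-cases (deg H v) (H-maxDegree2 v)
    where
    by-cases : ∀ k → k ≤ 2 → k ≡ ind ⌊ k N.≟ 1 ⌋ + 2 * ind ⌊ k N.≟ 2 ⌋
    by-cases 0 _ = refl
    by-cases 1 _ = refl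
    by-cases 2 _ = refl
    by-cases (suc (suc (suc _))) (s≤s (s≤s ()))

  endpoints≤2 : ∀ r → countIn (comp r) deg1ᵇ ≤ 2
  endpoints≤2 r with countIn (comp r) deg1ᵇ ≤? 2
  ... | yes ≤2 = ≤2
  ... | no ≰2 with count≥3⇒three _ (≰⇒> ≰2)
  ... | i , j , k , ri , rj , rk , i≢j , i≢k , j≢k =
    ⊥-elim (no-three-ends H H-undirected H-maxDegree2 i≢j i≢k j≢k (end ri) (end rj) (end rk)
              (within (∧-trueˡ ri) (∧-trueˡ rj)) (within (∧-trueˡ ri) (∧-trueˡ rk)))
    where
    end : ∀ {x} → comp r x ∧ deg1ᵇ x ≡ true → deg H x ≡ 1
    end {x} p = ⌊⌋-true⁻ (deg H x N.≟ 1) (∧-trueʳ p)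
    within : ∀ {x y} → comp r x ≡ true → comp r y ≡ true → Walk H x y
    within rx ry = walk-reverse H-undirected (comp-walk rx) ++ʷ comp-walk ry

  opaque
    isCycleᵇ : Fin n → Bool
    isCycleᵇ r = allᵇ (λ v → not (comp r v) ∨ deg2ᵇ v)

    isCycleᵇ-true⁻ : ∀ {r} → isCycleᵇ r ≡ true → IsCycleComp H (comp r)
    isCycleᵇ-true⁻ {r} p v rv with allᵇ-true⁻ _ p v
    ... | q rewrite rv = ⌊⌋-true⁻ (deg H v N.≟ 2) q

    isCycleᵇ-true⁺ : ∀ {r} → IsCycleComp H (comp r) → isCycleᵇ r ≡ true
    isCycleᵇ-true⁺ {r} cycle = allᵇ-true⁺ _ pointwise
      where
      pointwise : ∀ v → not (comp r v) ∨ deg2ᵇ v ≡ true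
      pointwise v with comp r v in rv
      ... | false = refl
      ... | true  = ⌊⌋-true⁺ (deg H v N.≟ 2) (cycle v rv)

  isCycleᵇ-false⁻ : ∀ {r} → isCycleᵇ r ≡ false → IsPathComp H (comp r)
  isCycleᵇ-false⁻ p cycle = true≢false (isCycleᵇ-true⁺ cycle) p

  isCycleᵇ-same : ∀ {r v} → comp r v ≡ true → isCycleᵇ v ≡ isCycleᵇ r
  isCycleᵇ-same rv =
    bool-ext (λ p → isCycleᵇ-true⁺ (λ x rx → isCycleᵇ-true⁻ p x (trans (comp-same rv x) rx)))
             (λ p → isCycleᵇ-true⁺ (λ x vx → isCycleᵇ-true⁻ p x (trans (sym (comp-same rv x)) vx)))

  cycle-deg≡2 : ∀ {r} → isCycleᵇ r ≡ true → deg H r ≡ 2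
  cycle-deg≡2 {r} cycle = isCycleᵇ-true⁻ cycle r (comp-refl r)

  longInnerᵇ : Fin n → Bool
  longInnerᵇ w = deg2ᵇ w ∧ (not (isCycleᵇ w) ∧ ⌊ 4 ≤? size w ⌋)

  isLink link : ESet n
  isLink v w = adj G v w ∧ (not (deg2ᵇ v) ∧ longInnerᵇ w)
  link v w = isLink v w ∨ isLink w v

  link-undirected : Undirected link
  link-undirected v w = BP.∨-comm (isLink v w) (isLink w v)

  link-adjacent : ∀ {v w} → link v w ≡ true → adj G v w ≡ true
  link-adjacent {v} {w} p with ∨-true⁻ {isLink v w} p
  ... | inj₁ vw = ∧-trueˡ {adj G v w} vw
  ... | inj₂ wv = trans (G-undirected v w) (∧-trueˡ {adj G w v} wv)

  InnerOfPath⇒longInner : ∀ {w} → InnerOfPath H 4 w → longInnerᵇ w ≡ true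
  InnerOfPath⇒longInner {w} (C , isComp , path , 4≤C , Cw , inner) =
    ∧-true⁺ (⌊⌋-true⁺ (deg H w N.≟ 2) inner)
            (∧-true⁺ (not-true⁺ (¬true⇒false notCycle)) (⌊⌋-true⁺ (4 ≤? size w) (subst (4 ≤_) C≡comp 4≤C)))
    where
    C≡comp : compEdges H C ≡ size w
    C≡comp = compEdges-cong (IsComp⇒comp isComp Cw)
    notCycle : isCycleᵇ w ≢ true
    notCycle cycle = path (λ v Cv → isCycleᵇ-true⁻ cycle v (trans (sym (IsComp⇒comp isComp Cw v)) Cv))

  isLink-source : ∀ {v w} → isLink v w ≡ true → deg2ᵇ v ≡ false
  isLink-source {v} {w} p = not-true⁻ (∧-trueˡ {not (deg2ᵇ v)} (∧-trueʳ {adj G v w} p))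

  isLink-target : ∀ {v w} → isLink v w ≡ true → longInnerᵇ w ≡ true
  isLink-target {v} {w} p = ∧-trueʳ {not (deg2ᵇ v)} (∧-trueʳ {adj G v w} p)

  long-path : ∀ {w} → longInnerᵇ w ≡ true → isCycleᵇ w ≡ false
  long-path {w} p = not-true⁻ (∧-trueˡ {not (isCycleᵇ w)} (∧-trueʳ {deg2ᵇ w} p))

  long-size : ∀ {w} → longInnerᵇ w ≡ true → 4 ≤ size w
  long-size {w} p = ⌊⌋-true⁻ (4 ≤? size w) (∧-trueʳ {not (isCycleᵇ w)} (∧-trueʳ {deg2ᵇ w} p))

  link-not-cycle : ∀ {v w} → link v w ≡ true → isCycleᵇ v ≡ false
  link-not-cycle {v} {w} p with ∨-true⁻ {isLink v w} p
  ... | inj₁ vw = ¬true⇒false λ cycle → true≢false (⌊⌋-true⁺ (deg H v N.≟ 2) (cycle-deg≡2 cycle)) (isLink-source vw)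
  ... | inj₂ wv = long-path (isLink-target wv)

  link-short-endpoint : ∀ {v w} → link v w ≡ true → size v ≤ 3 → ¬ deg H v ≡ 2
  link-short-endpoint {v} {w} p size≤3 with ∨-true⁻ {isLink v w} p
  ... | inj₁ vw = λ deg≡2 → true≢false (⌊⌋-true⁺ (deg H v N.≟ 2) deg≡2) (isLink-source vw)
  ... | inj₂ wv = ⊥-elim (<⇒≱ (s≤s size≤3) (long-size (isLink-target wv)))

  nonH : ESet n
  nonH a b = adj G a b ∧ not (H a b)

  nonH-undirected : Undirected nonH
  nonH-undirected a b rewrite G-undirected a b | H-undirected a b = refl

  Hedges linkEdges nonHedges : List (Fin n × Fin n)
  Hedges    = edgeList H
  linkEdges = edgeList link
  nonHedges = edgeList nonH

  G-edge-listed : ∀ {u v} → adj G u v ≡ true → Listed Hedges u v ⊎ Listed nonHedges u v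
  G-edge-listed {u} {v} g with H u v in h | u FinP.≟ v
  ... | _     | yes refl = ⊥-elim (true≢false g (irrefl G u))
  ... | true  | no u≢v   = inj₁ (edgeList-covers H H-undirected h u≢v)
  ... | false | no u≢v   = inj₂ (edgeList-covers nonH nonH-undirected (∧-true⁺ g (not-true⁺ h)) u≢v)

  greedy-spans : ∀ (l : List (Fin n × Fin n)) → (∀ {u v} → Listed Hedges u v ⊎ Listed nonHedges u v → Listed l u v) →
    Connected (greedy ∅ᴱ l)
  greedy-spans l covers u v = walk-refine edge (connected u v)
    where
    edge : ∀ a b → adj G a b ≡ true → Walk (greedy ∅ᴱ l) a b
    edge a b g = Listed-walk _ (greedy-undirected ∅ᴱ l (λ _ _ → refl)) l (greedy-connects ∅ᴱ l) (covers (G-edge-listed g))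

  T₀-prefix : ESet n
  T₀-prefix = greedy ∅ᴱ (Hedges ++ linkEdges)

  opaque
    T₀ : ESet n
    T₀ = greedy ∅ᴱ ((Hedges ++ linkEdges) ++ nonHedges)

    T₀-split : ∀ a b → T₀ a b ≡ greedy T₀-prefix nonHedges a b
    T₀-split a b = cong (λ E → E a b) (greedy-++ ∅ᴱ (Hedges ++ linkEdges) nonHedges)

    T₀-connected : Connected T₀
    T₀-connected = greedy-spans _ λ where
      (inj₁ uv) → Listed-++ˡ nonHedges (Listed-++ˡ linkEdges uv)
      (inj₂ uv) → Listed-++ʳ (Hedges ++ linkEdges) uv

  opaque
    exits : Fin n → Bool
    exits y = anyᵇ (λ z → T₀ y z ∧ not (comp y z))

    exits-true⁻ : ∀ y → exits y ≡ true → ∃ λ z → T₀ y z ≡ true × comp y z ≡ false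
    exits-true⁻ y p with anyᵇ-true⁻ (λ z → T₀ y z ∧ not (comp y z)) p
    ... | z , q = z , ∧-trueˡ q , not-true⁻ (∧-trueʳ q)

    exits-true⁺ : ∀ y z → T₀ y z ≡ true → comp y z ≡ false → exits y ≡ true
    exits-true⁺ y z p q = anyᵇ-true⁺ (λ z → T₀ y z ∧ not (comp y z)) z (∧-true⁺ p (not-true⁺ q))

  opaque
    isAnchor : Fin n → Bool
    isAnchor a = isCycleᵇ a ∧ (exits a ∧ allᵇ (λ y → not (ltF y a ∧ (comp a y ∧ exits y))))

    isAnchor-cycle : ∀ a → isAnchor a ≡ true → isCycleᵇ a ≡ true
    isAnchor-cycle a p = ∧-trueˡ p

    isAnchor-exits : ∀ a → isAnchor a ≡ true → exits a ≡ true
    isAnchor-exits a p = ∧-trueˡ (∧-trueʳ {isCycleᵇ a} p)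

    isAnchor-least : ∀ a y → isAnchor a ≡ true → ltF y a ≡ true → comp a y ≡ true → exits y ≡ true → ⊥
    isAnchor-least a y p y<a ay ey = true≢false none-earlier (cong not (∧-true⁺ y<a (∧-true⁺ ay ey)))
      where
      none-earlier : not (ltF y a ∧ (comp a y ∧ exits y)) ≡ true
      none-earlier = allᵇ-true⁻ (λ y → not (ltF y a ∧ (comp a y ∧ exits y))) (∧-trueʳ {exits a} (∧-trueʳ {isCycleᵇ a} p)) y

    isAnchor-true⁺ : ∀ a → isCycleᵇ a ≡ true → exits a ≡ true →
      (∀ y → ltF y a ≡ true → comp a y ≡ true → exits y ≡ true → ⊥) → isAnchor a ≡ true
    isAnchor-true⁺ a cycle ea least = ∧-true⁺ cycle (∧-true⁺ ea (allᵇ-true⁺ _ none-earlier))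
      where
      none-earlier : ∀ y → not (ltF y a ∧ (comp a y ∧ exits y)) ≡ true
      none-earlier y with ltF y a in y<a | comp a y in ay | exits y in ey
      ... | false | _     | _     = refl
      ... | true  | false | _     = refl
      ... | true  | true  | false = refl
      ... | true  | true  | true  = ⊥-elim (least y y<a ay ey)

  opaque
    isBreak : Fin n → Fin n → Bool
    isBreak a b = isAnchor a ∧ (H a b ∧ allᵇ (λ b' → not (ltF b' b ∧ H a b')))

    isBreak-anchor : ∀ a b → isBreak a b ≡ true → isAnchor a ≡ true
    isBreak-anchor a b p = ∧-trueˡ p

    isBreak-H : ∀ a b → isBreak a b ≡ true → H a b ≡ true
    isBreak-H a b p = ∧-trueˡ (∧-trueʳ {isAnchor a} p)

    isBreak-least : ∀ a b b' → isBreak a b ≡ true → ltF b' b ≡ true → H a b' ≡ true → ⊥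
    isBreak-least a b b' p b'<b ab' = true≢false none-earlier (cong not (∧-true⁺ b'<b ab'))
      where
      none-earlier : not (ltF b' b ∧ H a b') ≡ true
      none-earlier = allᵇ-true⁻ (λ b' → not (ltF b' b ∧ H a b')) (∧-trueʳ {H a b} (∧-trueʳ {isAnchor a} p)) b'

    isBreak-true⁺ : ∀ a b → isAnchor a ≡ true → H a b ≡ true →
      (∀ b' → ltF b' b ≡ true → H a b' ≡ true → ⊥) → isBreak a b ≡ true
    isBreak-true⁺ a b anchor ab least = ∧-true⁺ anchor (∧-true⁺ ab (allᵇ-true⁺ _ none-earlier))
      where
      none-earlier : ∀ b' → not (ltF b' b ∧ H a b') ≡ true
      none-earlier b' with ltF b' b in b'<b | H a b' in ab'
      ... | false | _     = refl
      ... | true  | false = refl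
      ... | true  | true  = ⊥-elim (least b' b'<b ab')

  isBreak-cycle : ∀ {a b} → isBreak a b ≡ true → isCycleᵇ a ≡ true
  isBreak-cycle {a} {b} p = isAnchor-cycle a (isBreak-anchor a b p)

  isBreak-exits : ∀ {a b} → isBreak a b ≡ true → ∃ λ z → T₀ a z ≡ true × comp a z ≡ false
  isBreak-exits {a} {b} p = exits-true⁻ a (isAnchor-exits a (isBreak-anchor a b p))

  opaque
    break-exists : ∀ r → isCycleᵇ r ≡ true → ∃ λ a → ∃ λ b → comp r a ≡ true × isBreak a b ≡ true
    break-exists r cycle = anchor , b , r-anchor , isBreak-true⁺ anchor b isAnchor-anchor anchor-b least-b
      where
      -- T₀ is connected and the component is not everything, so some T₀-edge leaves it.
      leaving : ∃ λ a → ∃ λ z → comp r a ≡ true × comp r z ≡ false × T₀ a z ≡ true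
      leaving = walk-leaves (comp r) (T₀-connected r (proj₁ (comp-proper r))) (comp-refl r) (proj₂ (comp-proper r))
      a₀ z₀ : Fin n
      a₀ = proj₁ leaving
      z₀ = proj₁ (proj₂ leaving)
      r-a₀ : comp r a₀ ≡ true
      r-a₀ = proj₁ (proj₂ (proj₂ leaving))
      exits-a₀ : exits a₀ ≡ true
      exits-a₀ = exits-true⁺ a₀ z₀ (proj₂ (proj₂ (proj₂ (proj₂ leaving))))
                   (trans (comp-same r-a₀ z₀) (proj₁ (proj₂ (proj₂ (proj₂ leaving)))))
      least-exit : ∃ λ m → comp r m ∧ exits m ≡ true × (∀ j → ltF j m ≡ true → comp r j ∧ exits j ≡ false)
      least-exit = least (λ y → comp r y ∧ exits y) a₀ (∧-true⁺ r-a₀ exits-a₀)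
      anchor : Fin n
      anchor = proj₁ least-exit
      r-anchor : comp r anchor ≡ true
      r-anchor = ∧-trueˡ {comp r anchor} (proj₁ (proj₂ least-exit))
      isAnchor-anchor : isAnchor anchor ≡ true
      isAnchor-anchor = isAnchor-true⁺ anchor (trans (isCycleᵇ-same r-anchor) cycle)
        (∧-trueʳ {comp r anchor} (proj₁ (proj₂ least-exit)))
        (λ y y<a ay ey → true≢false (∧-true⁺ (trans (sym (comp-same r-anchor y)) ay) ey) (proj₂ (proj₂ least-exit) y y<a))
      some-neighbour : ∃ λ b₀ → H anchor b₀ ≡ true
      some-neighbour = count>0⇒∃ (H anchor)
        (subst (0 <_) (sym (cycle-deg≡2 (trans (isCycleᵇ-same r-anchor) cycle))) (s≤s z≤n))
      least-neighbour : ∃ λ m → H anchor m ≡ true × (∀ j → ltF j m ≡ true → H anchor j ≡ false)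
      least-neighbour = least (H anchor) (proj₁ some-neighbour) (proj₂ some-neighbour)
      b : Fin n
      b = proj₁ least-neighbour
      anchor-b : H anchor b ≡ true
      anchor-b = proj₁ (proj₂ least-neighbour)
      least-b : ∀ b' → ltF b' b ≡ true → H anchor b' ≡ true → ⊥
      least-b b' b'<b ab' = true≢false ab' (proj₂ (proj₂ least-neighbour) b' b'<b)

  anchor-unique : ∀ {a a'} → isAnchor a ≡ true → isAnchor a' ≡ true → comp a a' ≡ true → a ≡ a'
  anchor-unique {a} {a'} p p' aa' = ltF-false⇒≡ a a' a≮a' a'≮a
    where
    a'≮a : ltF a' a ≡ false
    a'≮a = ¬true⇒false (λ lt → isAnchor-least a a' p lt aa' (isAnchor-exits a' p'))
    a≮a' : ltF a a' ≡ false
    a≮a' = ¬true⇒false (λ lt → isAnchor-least a' a p' lt (comp-sym aa') (isAnchor-exits a p))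

  break-unique : ∀ {a b a' b'} → isBreak a b ≡ true → isBreak a' b' ≡ true → comp a a' ≡ true → a ≡ a' × b ≡ b'
  break-unique {a} {b} {a'} {b'} p p' aa' with anchor-unique (isBreak-anchor a b p) (isBreak-anchor a' b' p') aa'
  ... | refl = refl , ltF-false⇒≡ b b' b≮b' b'≮b
    where
    b≮b' : ltF b b' ≡ false
    b≮b' = ¬true⇒false (λ lt → isBreak-least a b' b p' lt (isBreak-H a b p))
    b'≮b : ltF b' b ≡ false
    b'≮b = ¬true⇒false (λ lt → isBreak-least a b b' p lt (isBreak-H a b' p'))

  broken kept : ESet n
  broken u v = isBreak u v ∨ isBreak v u
  kept u v = H u v ∧ not (broken u v)

  broken⇒break : ∀ {a b x y} → isBreak a b ≡ true → comp a x ≡ true → H x y ≡ true → broken x y ≡ true →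
    (x ≡ a × y ≡ b) ⊎ (x ≡ b × y ≡ a)
  broken⇒break {a} {b} {x} {y} ab ax h p with ∨-true⁻ {isBreak x y} p
  ... | inj₁ xy with break-unique ab xy ax
  ...   | refl , refl = inj₁ (refl , refl)
  broken⇒break {a} {b} {x} {y} ab ax h p | inj₂ yx with break-unique ab yx (comp-closed a x y ax h)
  ...   | refl , refl = inj₂ (refl , refl)

  path-not-broken : ∀ x y → isCycleᵇ x ≡ false → H x y ≡ true → broken x y ≡ false
  path-not-broken x y path h = ¬true⇒false is-broken
    where
    is-broken : broken x y ≢ true
    is-broken p with ∨-true⁻ {isBreak x y} p
    ... | inj₁ xy = true≢false (isBreak-cycle xy) path
    ... | inj₂ yx = true≢false (trans (sym (isCycleᵇ-same {r = x} (comp-∋ (step h here)))) (isBreak-cycle yx)) path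

  kept-undirected : Undirected kept
  kept-undirected u v rewrite H-undirected u v | BP.∨-comm (isBreak u v) (isBreak v u) = refl

  kept⊆H : kept ⊆ᴱ H
  kept⊆H a b p = ∧-trueˡ p

  -- An edge of H on a cycle of H spans a whole cycle component, whose break is not kept.
  kept-acyclic : ∀ (E : ESet n) → Undirected E → E ⊆ᴱ kept →
    ∀ {u v} → kept u v ≡ true → E u v ≡ false → Walk E u v → ⊥
  kept-acyclic E undirected E⊆kept {u} {v} kept-uv ¬uv w = true≢false kept-ab (cong not (∨-trueˡ (isBreak b a) isBreak-ab))
    where
    E+uv = addEdge E u v
    E+uv⊆kept : E+uv ⊆ᴱ kept
    E+uv⊆kept a b p with ∨-true⁻ {E a b} p
    ... | inj₁ old = E⊆kept a b old
    ... | inj₂ new with isPair-true⁻ u v a b new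
    ...   | inj₁ (refl , refl) = kept-uv
    ...   | inj₂ (refl , refl) = trans (kept-undirected a b) kept-uv
    not-uv : ∀ a b → E a b ≡ true → isPair u v a b ≡ false
    not-uv a b e = ¬true⇒false is-uv
      where
      is-uv : isPair u v a b ≢ true
      is-uv ip with isPair-true⁻ u v a b ip
      ... | inj₁ (refl , refl) = true≢false e ¬uv
      ... | inj₂ (refl , refl) = true≢false (trans (undirected u v) e) ¬uv
    around : Walk (deleteEdge E+uv u v) u v
    around = walk-map (λ a b e → ∧-true⁺ (∨-trueˡ (isPair u v a b) e) (not-true⁺ (not-uv a b e))) w
    filled = cycle-edge⇒cycle-component H E+uv H-undirected H-loopless H-maxDegree2
               (addEdge-undirected E u v undirected) (λ a b p → kept⊆H a b (E+uv⊆kept a b p))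
               (∨-trueʳ (E u v) (isPair-refl u v)) around
    cycle : isCycleᵇ u ≡ true
    cycle = isCycleᵇ-true⁺ (λ x ux → proj₁ (filled x (comp-walk ux)))
    brk = break-exists u cycle
    a = proj₁ brk
    b = proj₁ (proj₂ brk)
    isBreak-ab = proj₂ (proj₂ (proj₂ brk))
    kept-ab : not (broken a b) ≡ true
    kept-ab = ∧-trueʳ (E+uv⊆kept a b (proj₂ (filled a (comp-walk (proj₁ (proj₂ (proj₂ brk))))) b (isBreak-H a b isBreak-ab)))

  greedyStep-⊆ : ∀ (E : ESet n) u v (K : ESet n) → Undirected K → E ⊆ᴱ K → K u v ≡ true → greedyStep E (u , v) ⊆ᴱ K
  greedyStep-⊆ E u v K undirected E⊆K uv a b p with greedyStep-origin E u v a b p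
  ... | inj₁ old                 = E⊆K a b old
  ... | inj₂ (inj₁ (refl , refl)) = uv
  ... | inj₂ (inj₂ (refl , refl)) = trans (undirected a b) uv

  greedy-accepts-kept : ∀ l (E : ESet n) → Undirected E → E ⊆ᴱ kept → (∀ u v → (u , v) ∈ l → kept u v ≡ true) →
    ∀ u v → (u , v) ∈ l → greedy E l u v ≡ true
  greedy-accepts-kept ((u , v) ∷ l) E undirected E⊆kept all-kept x y (here refl) = greedy-⊇ _ l u v accepted
    where
    accepted : greedyStep E (u , v) u v ≡ true
    accepted with E u v in e
    ... | true = greedyStep-⊇ E (u , v) u v e
    ... | false with greedyStep-accepts-or-connected E u v
    ...   | inj₁ acc = acc
    ...   | inj₂ w   = ⊥-elim (kept-acyclic E undirected E⊆kept (all-kept u v (here refl)) e w)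
  greedy-accepts-kept ((u , v) ∷ l) E undirected E⊆kept all-kept x y (there m) =
    greedy-accepts-kept l (greedyStep E (u , v)) (greedyStep-undirected E (u , v) undirected)
      (greedyStep-⊆ E u v kept kept-undirected E⊆kept (all-kept u v (here refl))) (λ a b m' → all-kept a b (there m')) x y m

  keptEdges : List (Fin n × Fin n)
  keptEdges = edgeList kept

  T₁ T₂ T₃ : ESet n
  T₁ = greedy ∅ᴱ keptEdges
  T₂ = greedy T₁ linkEdges
  T₃ = greedy T₂ nonHedges

  order : List (Fin n × Fin n)
  order = ((keptEdges ++ linkEdges) ++ nonHedges) ++ Hedges

  order-adjacent : ∀ {u v} → Listed order u v → adj G u v ≡ true
  order-adjacent uv with Listed-++⁻ ((keptEdges ++ linkEdges) ++ nonHedges) uv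
  ... | inj₂ inH = H⊆G _ _ (edgeList-Listed⁻ H-undirected inH)
  ... | inj₁ uv′ with Listed-++⁻ (keptEdges ++ linkEdges) uv′
  ...   | inj₂ inNonH = ∧-trueˡ (edgeList-Listed⁻ nonH-undirected inNonH)
  ...   | inj₁ uv″ with Listed-++⁻ keptEdges uv″
  ...     | inj₁ inKept  = H⊆G _ _ (kept⊆H _ _ (edgeList-Listed⁻ kept-undirected inKept))
  ...     | inj₂ inLinks = link-adjacent (edgeList-Listed⁻ link-undirected inLinks)

  opaque
    T : ESet n
    T = greedy ∅ᴱ order

    T-stages : ∀ a b → T a b ≡ greedy T₃ Hedges a b
    T-stages a b = cong (λ E → E a b) (begin
      greedy ∅ᴱ order
        ≡⟨ greedy-++ ∅ᴱ ((keptEdges ++ linkEdges) ++ nonHedges) Hedges ⟩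
      greedy (greedy ∅ᴱ ((keptEdges ++ linkEdges) ++ nonHedges)) Hedges
        ≡⟨ cong (λ E → greedy E Hedges) (greedy-++ ∅ᴱ (keptEdges ++ linkEdges) nonHedges) ⟩
      greedy (greedy (greedy ∅ᴱ (keptEdges ++ linkEdges)) nonHedges) Hedges
        ≡⟨ cong (λ E → greedy (greedy E nonHedges) Hedges) (greedy-++ ∅ᴱ keptEdges linkEdges) ⟩
      greedy T₃ Hedges ∎)
      where open ≡-Reasoning

    T-undirected : Undirected T
    T-undirected = greedy-undirected ∅ᴱ order (λ _ _ → refl)

    T-bridges : EdgesAreBridges T
    T-bridges = bridges-greedy ∅ᴱ order (λ _ _ → refl) (λ _ _ ())

    T⊆G : T ⊆ᴱ adj G
    T⊆G a b p with greedy-origin ∅ᴱ order a b p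
    ... | inj₂ listed = order-adjacent listed

    T-connected : Connected T
    T-connected = greedy-spans order λ where
      (inj₁ uv) → Listed-++ʳ ((keptEdges ++ linkEdges) ++ nonHedges) uv
      (inj₂ uv) → Listed-++ˡ Hedges (Listed-++ʳ (keptEdges ++ linkEdges) uv)

  T₃⊆T : T₃ ⊆ᴱ T
  T₃⊆T a b p = trans (T-stages a b) (greedy-⊇ T₃ Hedges a b p)

  T₂⊆T : T₂ ⊆ᴱ T
  T₂⊆T a b p = T₃⊆T a b (greedy-⊇ T₂ nonHedges a b p)

  keptEdges-in-T₁ : ∀ {x y} → (x , y) ∈ keptEdges → T₁ x y ≡ true
  keptEdges-in-T₁ = greedy-accepts-kept keptEdges ∅ᴱ (λ _ _ → refl) (λ _ _ ()) (λ a b m → edgeList-∈⁻ kept m) _ _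

  kept⊆T : kept ⊆ᴱ T
  kept⊆T u v h with u FinP.≟ v
  ... | yes refl = ⊥-elim (true≢false (kept⊆H u u h) (H-loopless u))
  ... | no u≢v with edgeList-covers kept kept-undirected h u≢v
  ...   | inj₁ uv = T₂⊆T u v (greedy-⊇ T₁ linkEdges u v (keptEdges-in-T₁ uv))
  ...   | inj₂ vu = trans (T-undirected u v) (T₂⊆T v u (greedy-⊇ T₁ linkEdges v u (keptEdges-in-T₁ vu)))

  H⊆T-unless-broken : ∀ x y → H x y ≡ true → broken x y ≡ false → T x y ≡ true
  H⊆T-unless-broken x y h unbroken = kept⊆T x y (∧-true⁺ h (not-true⁺ unbroken))

  T₁-respects-comp : ∀ r → Respects T₁ (comp r)
  T₁-respects-comp r a b p with greedy-origin ∅ᴱ keptEdges a b p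
  ... | inj₂ listed = H-respects-comp r a b (kept⊆H a b (edgeList-Listed⁻ kept-undirected listed))

  T-has-link : ∀ r → isCycleᵇ r ≡ false → 1 ≤ size r → size r ≤ 3 →
    ∃ λ v → ∃ λ w → comp r v ≡ true × ¬ deg H v ≡ 2 × comp r w ≡ false × T v w ≡ true
  T-has-link r path 1≤size size≤3 with shortPaths (comp r) (comp-isComp r) (isCycleᵇ-false⁻ path) 1≤size size≤3
  ... | v , rv , endpoint , w , vw , inner = accepted (greedy-crosses linkEdges T₁ (comp r) (T₁-respects-comp r) offered)
    where
    rw : comp r w ≡ false
    rw = ¬true⇒false (λ rw → <⇒≱ (s≤s size≤3) (subst (4 ≤_) (size-same rw) (long-size (InnerOfPath⇒longInner inner))))
    link-vw : link v w ≡ true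
    link-vw = ∨-trueˡ (isLink w v)
      (∧-true⁺ vw (∧-true⁺ (not-true⁺ (⌊⌋-false⁺ (deg H v N.≟ 2) endpoint)) (InnerOfPath⇒longInner inner)))
    offered : ∃ λ x → ∃ λ y → (x , y) ∈ linkEdges × ¬ comp r x ≡ comp r y
    offered with edgeList-covers link link-undirected link-vw (λ { refl → true≢false rv rw })
    ... | inj₁ vw∈ = v , w , vw∈ , (λ same → true≢false (trans (sym same) rv) rw)
    ... | inj₂ wv∈ = w , v , wv∈ , (λ same → true≢false (trans same rv) rw)
    short : ∀ {x} → comp r x ≡ true → size x ≤ 3
    short rx = ≤-trans (≤-reflexive (size-same rx)) size≤3
    accepted : (∃ λ x → ∃ λ y → (x , y) ∈ linkEdges × ¬ comp r x ≡ comp r y × T₂ x y ≡ true) →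
      ∃ λ v → ∃ λ w → comp r v ≡ true × ¬ deg H v ≡ 2 × comp r w ≡ false × T v w ≡ true
    accepted (x , y , xy∈ , cross , T₂xy) with comp r x in rx | comp r y in ry
    ... | true  | false = x , y , rx , link-short-endpoint (edgeList-∈⁻ link xy∈) (short rx) , ry , T₂⊆T x y T₂xy
    ... | false | true  = y , x , ry , link-short-endpoint (trans (link-undirected y x) (edgeList-∈⁻ link xy∈)) (short ry) ,
                          rx , trans (T-undirected y x) (T₂⊆T x y T₂xy)
    ... | true  | true  = ⊥-elim (cross refl)
    ... | false | false = ⊥-elim (cross refl)

  T₂-within-T₀-prefix : ∀ a b → T₂ a b ≡ true → Walk T₀-prefix a b
  T₂-within-T₀-prefix a b p
    with greedy-origin ∅ᴱ (keptEdges ++ linkEdges) a b (trans (cong (λ E → E a b) (greedy-++ ∅ᴱ keptEdges linkEdges)) p)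
  ... | inj₂ listed = Listed-walk T₀-prefix (greedy-undirected ∅ᴱ (Hedges ++ linkEdges) (λ _ _ → refl))
                        (Hedges ++ linkEdges) (greedy-connects ∅ᴱ (Hedges ++ linkEdges)) (relist listed)
    where
    kept⊆Hedges : ∀ {x y} → (x , y) ∈ keptEdges → (x , y) ∈ Hedges
    kept⊆Hedges {x} {y} m = edgeList-∈⁺ H (∧-true⁺ (kept⊆H x y (∧-trueˡ ordered)) (∧-trueʳ ordered))
      where ordered = edgeList-∈⁻-ordered kept m
    relist′ : ∀ {x y} → (x , y) ∈ keptEdges ++ linkEdges → (x , y) ∈ Hedges ++ linkEdges
    relist′ m with ∈-++⁻ keptEdges m
    ... | inj₁ inKept  = ∈-++⁺ˡ (kept⊆Hedges inKept)
    ... | inj₂ inLinks = ∈-++⁺ʳ Hedges inLinks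
    relist : Listed (keptEdges ++ linkEdges) a b → Listed (Hedges ++ linkEdges) a b
    relist (inj₁ m) = inj₁ (relist′ m)
    relist (inj₂ m) = inj₂ (relist′ m)

  -- The exit edge of an anchor survives in T: T₀ and T see the same connectivity when the
  -- non-H edges are offered, and an exit edge is neither an edge of H nor a link.
  T-exit : ∀ a z → T₀ a z ≡ true → isCycleᵇ a ≡ true → comp a z ≡ false → T a z ≡ true
  T-exit a z T₀az cycle az
    with greedy-compare nonHedges T₀-prefix T₂ (greedy-undirected ∅ᴱ (Hedges ++ linkEdges) (λ _ _ → refl))
           T₂-within-T₀-prefix a z (trans (sym (T₀-split a z)) T₀az)
  ... | inj₂ T₃az = T₃⊆T a z T₃az
  ... | inj₁ prefix-az with greedy-origin ∅ᴱ (Hedges ++ linkEdges) a z prefix-az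
  ...   | inj₂ listed with Listed-++⁻ Hedges listed
  ...     | inj₁ inH     = ⊥-elim (true≢false (comp-closed a a z (comp-refl a) (edgeList-Listed⁻ H-undirected inH)) az)
  ...     | inj₂ inLinks = ⊥-elim (true≢false cycle (link-not-cycle (edgeList-Listed⁻ link-undirected inLinks)))

  internalᵇ : Fin n → Bool
  internalᵇ v = ⌊ 2 ≤? deg T v ⌋

  internal⁺ : ∀ {v} → 2 ≤ deg T v → internalᵇ v ≡ true
  internal⁺ {v} = ⌊⌋-true⁺ (2 ≤? deg T v)

  -- Doubling 3 |E(H)| ≤ 4 (internal vertices) turns it into a comparison of vertex weights.
  cost credit : Fin n → ℕ
  cost v   = 3 * deg H v
  credit v = 8 * ind (internalᵇ v)

  sumIn-cost : ∀ C → sumIn C cost ≡ 3 * (countIn C deg1ᵇ + 2 * countIn C deg2ᵇ)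
  sumIn-cost C = begin
    sumIn C (λ v → 3 * deg H v)
      ≡⟨ sumIn-* C 3 (deg H) ⟩
    3 * sumIn C (deg H)
      ≡⟨ cong (3 *_) (sumIn-cong C (λ v _ → deg-decompose v)) ⟩
    3 * sumIn C (λ v → ind (deg1ᵇ v) + 2 * ind (deg2ᵇ v))
      ≡⟨ cong (3 *_) (sumIn-+ C _ _) ⟩
    3 * (sumIn C (ind ∘ deg1ᵇ) + sumIn C (λ v → 2 * ind (deg2ᵇ v)))
      ≡⟨ cong (λ x → 3 * (sumIn C (ind ∘ deg1ᵇ) + x)) (sumIn-* C 2 _) ⟩
    3 * (sumIn C (ind ∘ deg1ᵇ) + 2 * sumIn C (ind ∘ deg2ᵇ))
      ≡⟨ cong₂ (λ x y → 3 * (x + 2 * y)) (sumIn-ind C deg1ᵇ) (sumIn-ind C deg2ᵇ) ⟩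
    3 * (countIn C deg1ᵇ + 2 * countIn C deg2ᵇ) ∎
    where open ≡-Reasoning

  sumIn-credit : ∀ C → sumIn C credit ≡ 8 * countIn C internalᵇ
  sumIn-credit C = trans (sumIn-* C 8 _) (cong (8 *_) (sumIn-ind C internalᵇ))

  path-degree-sum : ∀ r → countIn (comp r) deg1ᵇ + 2 * countIn (comp r) deg2ᵇ ≡ 2 * size r
  path-degree-sum r = *-cancelˡ-≡ _ _ 3 (trans (sym (sumIn-cost (comp r))) (trans (sumIn-* (comp r) 3 (deg H))
                        (cong (3 *_) (comp-handshake r))))

  path-inner-internal : ∀ r → isCycleᵇ r ≡ false → ∀ v → comp r v ≡ true → deg H v ≡ 2 → internalᵇ v ≡ true
  path-inner-internal r path v rv deg≡2 = internal⁺ (subst (_≤ deg T v) deg≡2 (deg-mono {E = H} {E' = T} v in-T))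
    where
    in-T : ∀ t → H v t ≡ true → T v t ≡ true
    in-T t h = H⊆T-unless-broken v t h (path-not-broken v t (trans (isCycleᵇ-same rv) path) h)

  inner≤internal : ∀ r → isCycleᵇ r ≡ false → countIn (comp r) deg2ᵇ ≤ countIn (comp r) internalᵇ
  inner≤internal r path = count-mono λ v p →
    ∧-true⁺ (∧-trueˡ p) (path-inner-internal r path v (∧-trueˡ p) (⌊⌋-true⁻ (deg H v N.≟ 2) (∧-trueʳ p)))

  -- On a short path the endpoint carrying the link is internal as well.
  short-inner<internal : ∀ r → isCycleᵇ r ≡ false → 1 ≤ size r → size r ≤ 3 →
    suc (countIn (comp r) deg2ᵇ) ≤ countIn (comp r) internalᵇ
  short-inner<internal r path 1≤size size≤3 with T-has-link r path 1≤size size≤3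
  ... | v , w , rv , endpoint , rw , T-vw = begin
    suc (countIn (comp r) deg2ᵇ)
      ≡⟨ count-insert _ v (trans (cong (_∧ deg2ᵇ v) rv) (⌊⌋-false⁺ (deg H v N.≟ 2) endpoint)) ⟨
    count (λ x → (comp r x ∧ deg2ᵇ x) ∨ eqF x v)
      ≤⟨ count-mono stays-internal ⟩
    countIn (comp r) internalᵇ ∎
    where
    open ≤-Reasoning
    t = proj₁ (has-neighbour r 1≤size v rv)
    vt : H v t ≡ true
    vt = proj₂ (has-neighbour r 1≤size v rv)
    internal-v : internalᵇ v ≡ true
    internal-v = internal⁺ (count≥2 (T v) t w
      (H⊆T-unless-broken v t vt (path-not-broken v t (trans (isCycleᵇ-same rv) path) vt)) T-vw
      (λ t≡w → true≢false (subst (λ y → comp r y ≡ true) t≡w (comp-closed r v t rv vt)) rw))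
    stays-internal : ∀ x → (comp r x ∧ deg2ᵇ x) ∨ eqF x v ≡ true → comp r x ∧ internalᵇ x ≡ true
    stays-internal x p with ∨-true⁻ {comp r x ∧ deg2ᵇ x} p
    ... | inj₁ inner = ∧-true⁺ (∧-trueˡ inner) (path-inner-internal r path x (∧-trueˡ inner) (⌊⌋-true⁻ (deg H x N.≟ 2) (∧-trueʳ inner)))
    ... | inj₂ x≡v with eqF-true⁻ {a = x} x≡v
    ...   | refl = ∧-true⁺ rv internal-v

  path-cost≤credit : ∀ r → isCycleᵇ r ≡ false → sumIn (comp r) cost ≤ sumIn (comp r) credit
  path-cost≤credit r path = subst₂ _≤_ (sym (sumIn-cost (comp r))) (sym (sumIn-credit (comp r))) ratio
    where
    ends = countIn (comp r) deg1ᵇ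
    inner = countIn (comp r) deg2ᵇ
    ratio : 3 * (ends + 2 * inner) ≤ 8 * countIn (comp r) internalᵇ
    ratio with 4 ≤? size r | 1 ≤? size r
    ... | yes 4≤size | _ = long-path-ratio (endpoints≤2 r)
                             (≤-trans (*-monoʳ-≤ 2 4≤size) (≤-reflexive (sym (path-degree-sum r)))) (inner≤internal r path)
    ... | no ≱4 | yes 1≤size = short-path-ratio (endpoints≤2 r) (short-inner<internal r path 1≤size (s≤s⁻¹ (≰⇒> ≱4)))
    ... | no _ | no ≱1 rewrite path-degree-sum r | n≤0⇒n≡0 (s≤s⁻¹ (≰⇒> ≱1)) = z≤n

  module CycleComponent (r : Fin n) (cycle : isCycleᵇ r ≡ true) where
    brk = break-exists r cycle
    a = proj₁ brk
    b = proj₁ (proj₂ brk)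
    ra : comp r a ≡ true
    ra = proj₁ (proj₂ (proj₂ brk))
    isBreak-ab : isBreak a b ≡ true
    isBreak-ab = proj₂ (proj₂ (proj₂ brk))
    ab : H a b ≡ true
    ab = isBreak-H a b isBreak-ab
    rb : comp r b ≡ true
    rb = comp-closed r a b ra ab
    a≢b : ¬ a ≡ b
    a≢b a≡b = true≢false (subst (λ y → H a y ≡ true) (sym a≡b) ab) (H-loopless a)

    deg≡2 : ∀ v → comp r v ≡ true → deg H v ≡ 2
    deg≡2 = isCycleᵇ-true⁻ cycle

    H⊆T-except-break : ∀ x y → comp r x ≡ true → H x y ≡ true → ¬ ((x ≡ a × y ≡ b) ⊎ (x ≡ b × y ≡ a)) → T x y ≡ true
    H⊆T-except-break x y rx h not-ab =
      H⊆T-unless-broken x y h (¬true⇒false (not-ab ∘ broken⇒break isBreak-ab (trans (comp-same ra x) rx) h))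

    other-neighbour : ∀ v → comp r v ≡ true → ∀ u → H v u ≡ true → ∃ λ t → H v t ≡ true × ¬ t ≡ u
    other-neighbour v rv u vu = t , ∧-trueˡ (proj₂ found) , remove-≢ (H v) (proj₂ found)
      where
      one-left : count (remove (H v) u) ≡ 1
      one-left = suc-injective (trans (sym (count-remove-true (H v) u vu)) (deg≡2 v rv))
      found = count>0⇒∃ (remove (H v) u) (≤-reflexive (sym one-left))
      t = proj₁ found

    -- Every vertex but b keeps both cycle edges in T, except the anchor a, which trades its
    -- cycle edge to b for its exit edge.
    cycle-internal : ∀ v → comp r v ≡ true → ¬ v ≡ b → internalᵇ v ≡ true
    cycle-internal v rv v≢b with v FinP.≟ a
    ... | no v≢a = internal⁺ (subst (_≤ deg T v) (deg≡2 v rv) (deg-mono {E = H} {E' = T} v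
                     (λ t h → H⊆T-except-break v t rv h (λ { (inj₁ (v≡a , _)) → v≢a v≡a ; (inj₂ (v≡b , _)) → v≢b v≡b }))))
    ... | yes refl with other-neighbour a ra b ab | isBreak-exits isBreak-ab
    ...   | t , at , t≢b | z , T₀az , az = internal⁺ (count≥2 (T a) t z T-at T-az t≢z)
      where
      T-at : T a t ≡ true
      T-at = H⊆T-except-break a t ra at (λ { (inj₁ (_ , t≡b)) → t≢b t≡b ; (inj₂ (a≡b , _)) → a≢b a≡b })
      T-az : T a z ≡ true
      T-az = T-exit a z T₀az (isBreak-cycle isBreak-ab) az
      t≢z : ¬ t ≡ z
      t≢z refl = true≢false (comp-∋ (step at here)) az

    vertices≡size : countIn (comp r) (λ _ → true) ≡ size r
    vertices≡size = *-cancelˡ-≡ _ _ 2 (begin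
      2 * countIn (comp r) (λ _ → true)   ≡⟨ cong (2 *_) (sumIn-ind (comp r) (λ _ → true)) ⟨
      2 * sumIn (comp r) (λ _ → 1)        ≡⟨ sumIn-* (comp r) 2 (λ _ → 1) ⟨
      sumIn (comp r) (λ _ → 2)            ≡⟨ sumIn-cong (comp r) (λ v rv → sym (deg≡2 v rv)) ⟩
      sumIn (comp r) (deg H)              ≡⟨ comp-handshake r ⟩
      2 * size r                          ∎)
      where open ≡-Reasoning

    vertices≤1+internal : countIn (comp r) (λ _ → true) ≤ suc (countIn (comp r) internalᵇ)
    vertices≤1+internal = begin
      count (λ v → comp r v ∧ true)                  ≡⟨ count-remove-true (λ v → comp r v ∧ true) b (∧-true⁺ rb refl) ⟩
      suc (count (remove (λ v → comp r v ∧ true) b)) ≤⟨ s≤s (count-mono stays-internal) ⟩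
      suc (countIn (comp r) internalᵇ)               ∎
      where
      open ≤-Reasoning
      stays-internal : ∀ v → remove (λ v → comp r v ∧ true) b v ≡ true → comp r v ∧ internalᵇ v ≡ true
      stays-internal v p = ∧-true⁺ (∧-trueˡ (∧-trueˡ p)) (cycle-internal v (∧-trueˡ (∧-trueˡ p)) (remove-≢ (λ v → comp r v ∧ true) p))

    cycle-cost≤credit : sumIn (comp r) cost ≤ sumIn (comp r) credit
    cycle-cost≤credit = subst₂ _≤_ cost≡ (sym (sumIn-credit (comp r)))
      (cycle-ratio (subst (4 ≤_) (sym vertices≡size) (cycles≥4 (comp r) (comp-isComp r) (isCycleᵇ-true⁻ cycle)))
                   vertices≤1+internal)
      where
      cost≡ : 3 * (2 * countIn (comp r) (λ _ → true)) ≡ sumIn (comp r) cost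
      cost≡ = sym (trans (sumIn-* (comp r) 3 (deg H)) (cong (3 *_) (trans (comp-handshake r) (cong (2 *_) (sym vertices≡size)))))

    cycle-joins : compEdges H (comp r) ≤ edgeCount (λ x y → restrictE (comp r) H x y ∧ T x y) + 1
    cycle-joins = begin
      edgeCount (restrictE (comp r) H)
        ≤⟨ edgeCount-deleteEdge (restrictE (comp r) H) (restrictE-undirected (comp r) {H} H-undirected) (restrictE-loopless (comp r) {H} H-loopless) a b ⟩
      edgeCount (deleteEdge (restrictE (comp r) H) a b) + 1
        ≤⟨ +-monoˡ-≤ 1 (edgeCount-mono kept-in-T) ⟩
      edgeCount (λ x y → restrictE (comp r) H x y ∧ T x y) + 1 ∎
      where
      open ≤-Reasoning
      kept-in-T : deleteEdge (restrictE (comp r) H) a b ⊆ᴱ (λ x y → restrictE (comp r) H x y ∧ T x y)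
      kept-in-T x y p = ∧-true⁺ inC (H⊆T-except-break x y (∧-trueˡ inC) (∧-trueʳ {comp r y} (∧-trueʳ {comp r x} inC)) not-ab)
        where
        inC : restrictE (comp r) H x y ≡ true
        inC = ∧-trueˡ p
        not-ab : ¬ ((x ≡ a × y ≡ b) ⊎ (x ≡ b × y ≡ a))
        not-ab (inj₁ (refl , refl)) = true≢false (∧-trueʳ p) (cong not (∨-trueˡ _ (∧-true⁺ (eqF-refl a) (eqF-refl b))))
        not-ab (inj₂ (refl , refl)) = true≢false (∧-trueʳ p) (cong not (∨-trueʳ (eqF b a ∧ eqF a b) (∧-true⁺ (eqF-refl b) (eqF-refl a))))

  cost≤credit : ∀ r → sumIn (comp r) cost ≤ sumIn (comp r) credit
  cost≤credit r with isCycleᵇ r in cycle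
  ... | true  = CycleComponent.cycle-cost≤credit r cycle
  ... | false = path-cost≤credit r cycle

  closed-cost≤credit : ∀ k (W : VSet n) → count W ≤ k → Closed H W → sumIn W cost ≤ sumIn W credit
  closed-cost≤credit k W |W|≤k closed with anyᵇ W in nonempty
  ... | false = ≤-reflexive (trans (sumIn-empty W cost empty) (sym (sumIn-empty W credit empty)))
    where
    empty : ∀ v → W v ≡ false
    empty v = ¬true⇒false (λ Wv → true≢false (anyᵇ-true⁺ W v Wv) nonempty)
  ... | true with anyᵇ-true⁻ W nonempty
  ... | r , Wr with k
  ...   | zero   = ⊥-elim (<⇒≱ (count≥1 W r Wr) |W|≤k)
  ...   | suc k′ = subst₂ _≤_ (sym (sumIn-split W (comp r) cost r⊆W)) (sym (sumIn-split W (comp r) credit r⊆W))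
                     (+-mono-≤ (cost≤credit r) (closed-cost≤credit k′ rest |rest|≤k′ rest-closed))
    where
    r⊆W : ∀ v → comp r v ≡ true → W v ≡ true
    r⊆W v rv = walk-stays closed Wr (comp-walk rv)
    rest : VSet n
    rest v = W v ∧ not (comp r v)
    |rest|≤k′ : count rest ≤ k′
    |rest|≤k′ = s≤s⁻¹ (≤-trans (count-< (λ i p → ∧-trueˡ p) r Wr r∉rest) |W|≤k)
      where
      r∉rest : rest r ≡ false
      r∉rest rewrite comp-refl r = BP.∧-zeroʳ (W r)
    rest-closed : Closed H rest
    rest-closed x y p h = ∧-true⁺ (closed x y (∧-trueˡ p) h)
      (not-true⁺ (¬true⇒false (λ ry → true≢false (comp-closed r y x ry (trans (H-undirected y x) h)) (not-true⁻ (∧-trueʳ p)))))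

  H-ratio : 3 * edgeCount H ≤ 4 * count internalᵇ
  H-ratio = *-cancelˡ-≤ 2 (subst₂ _≤_ cost-sum credit-sum (closed-cost≤credit n allV (count≤n _) (λ _ _ _ _ → refl)))
    where
    cost-sum : sumIn allV cost ≡ 2 * (3 * edgeCount H)
    cost-sum = trans (sumF-* 3 (deg H)) (trans (cong (3 *_) (handshake H H-undirected H-loopless)) (swap (edgeCount H)))
      where
      swap : ∀ e → 3 * (2 * e) ≡ 2 * (3 * e)
      swap = solve-∀
    credit-sum : sumIn allV credit ≡ 2 * (4 * count internalᵇ)
    credit-sum = trans (sumF-* 8 (ind ∘ internalᵇ)) (trans (cong (8 *_) (sym (count≡sumF-ind internalᵇ))) (swap (count internalᵇ)))
      where
      swap : ∀ e → 8 * e ≡ 2 * (4 * e)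
      swap = solve-∀

  joins : ∀ C → IsComp H C → ∀ D → (∀ v → D v ≡ true) → Joins H C D (restrictE D T)
  joins C isComp D full with isCycleᵇ x in cycle
    where x = proj₁ (proj₁ isComp)
  ... | false = inj₁ (path , (λ v _ → full v) , in-T)
    where
    x = proj₁ (proj₁ isComp)
    C≗comp : ∀ y → C y ≡ comp x y
    C≗comp = IsComp⇒comp isComp (proj₂ (proj₁ isComp))
    path : IsPathComp H C
    path cyc = true≢false (isCycleᵇ-true⁺ (λ v xv → cyc v (trans (C≗comp v) xv))) cycle
    in-T : ∀ a b → C a ≡ true → H a b ≡ true → restrictE D T a b ≡ true
    in-T a b Ca h = trans (restrictE-full D T full a b)
      (H⊆T-unless-broken a b h (path-not-broken a b (trans (isCycleᵇ-same (trans (sym (C≗comp a)) Ca)) cycle) h))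
  ... | true = inj₂ (cyc , (λ v _ → full v) , bound)
    where
    x = proj₁ (proj₁ isComp)
    C≗comp : ∀ y → C y ≡ comp x y
    C≗comp = IsComp⇒comp isComp (proj₂ (proj₁ isComp))
    cyc : IsCycleComp H C
    cyc v Cv = isCycleᵇ-true⁻ cycle v (trans (sym (C≗comp v)) Cv)
    bound : compEdges H C ≤ edgeCount (λ a b → restrictE C H a b ∧ restrictE D T a b) + 1
    bound = subst₂ (λ p q → p ≤ q + 1) (sym (compEdges-cong C≗comp))
      (edgeCount-cong (λ a b → sym (cong₂ _∧_ (cong₂ (λ p q → p ∧ q ∧ H a b) (C≗comp a) (C≗comp b)) (restrictE-full D T full a b))))
      (CycleComponent.cycle-joins x cycle)

  T-spanning-forest : SpanningForest G T
  T-spanning-forest = (T⊆G , T-undirected) , bridges⇒acyclic T T-undirected T-bridges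

  T-approximate : ∀ D → IsComp T D → ThreeQuarterApprox H D (restrictE D T)
  T-approximate D ((x , Dx) , isComp) = H , all-join , subst (λ i → 3 * edgeCount H ≤ 4 * i) (sym internal≡) H-ratio
    where
    full : ∀ v → D v ≡ true
    full v = proj₂ (isComp x Dx v) (T-connected x v)
    all-join : JoinEdgeSet H D (restrictE D T) H
    all-join a b = (λ h → h , comp a , comp-isComp a , comp-refl a , joins (comp a) (comp-isComp a) D full) , proj₁
    internal≡ : internal D (restrictE D T) ≡ count internalᵇ
    internal≡ = count-cong λ v →
      cong₂ _∧_ (full v) (cong (λ d → ⌊ 2 ≤? d ⌋) (count-cong (restrictE-full D T full v)))

  components-join : ∀ C → IsComp H C → ∃ λ D → IsComp T D × Joins H C D (restrictE D T)
  components-join C isComp = allV , ((proj₁ (proj₁ isComp) , refl) , λ u _ v → (λ _ → T-connected u v) , (λ _ → refl)) ,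
                             joins C isComp allV (λ _ → refl)


lemma16 : ∀ {n} (G : SimpleGraph n) →
    Connected (adj G) →
    ¬ IsTree G →
    Reduced G →
    (∀ H' → MaxPCC G H' → ¬ NComp allV H' 1) →
    (H : ESet n) → MaxPCC G H →
    (∀ C → IsComp H C → IsCycleComp H C → 4 ≤ compEdges H C) →
    (∀ C → IsComp H C → IsPathComp H C → compEdges H C ≡ 0 →
    ∀ v → C v ≡ true → ∃ λ w → adj G v w ≡ true × InnerOfPath H 0 w) →
    (∀ C → IsComp H C → IsPathComp H C → 1 ≤ compEdges H C → compEdges H C ≤ 3 →
    ∃ λ v → C v ≡ true × Endpoint H v ×
    (∃ λ w → adj G v w ≡ true × InnerOfPath H 4 w)) →
    ∃ λ F → SpanningForest G F ×
    (∀ D → IsComp F D → ThreeQuarterApprox H D (restrictE D F)) ×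
    (∀ C → IsComp H C → ∃ λ D → IsComp F D × Joins H C D (restrictE D F))
lemma16 G connected _ _ disconnected H maxH cycles≥4 _ shortPaths =
  T , T-spanning-forest , T-approximate , components-join
  where open Construction G H (proj₁ maxH) connected (disconnected H maxH) cycles≥4 shortPaths
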